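{- Let $\mathbb{A}$ be a slanted $\mathcal{L}_{\mathrm{LE}}$-algebra and $v$ an admissible assignment. Let $\alpha$ be a strictly syntactically open $\mathcal{L}^+_{\mathrm{LE}}$-term in which $p$ does not occur, let $\beta_1(p),\ldots,\beta_n(p)$ be strictly syntactically closed and negative in $p$, and let $\gamma_1(p),\ldots,\gamma_n(p)$ be strictly syntactically open and positive in $p$. Then $(\mathbb{A},v)\models\beta_i(\alpha/p)\leq\gamma_i(\alpha/p)$ for all $1\leq i\leq n$ if and only if there exists an admissible assignment $v'$ differing from $v$ at most at $p$ such that $(\mathbb{A},v')\models p\leq\alpha$ and $(\mathbb{A},v')\models\beta_i(p)\leq\gamma_i(p)$ for all $1\leq i\leq n$.
   Context: Setting. An LE-signature: disjoint sets $\mathcal{F},\mathcal{G}$ of connectives, each $h$ with arity $n_h$ and order-type $\epsilon_h\in\{1,\partial\}^{n_h}$. For a bounded lattice $A$, $A^\delta$ is its canonical extension (complete lattice containing $A$ as a dense and compact sublattice); $K(A^\delta)$ closed elements (meets of subsets of $A$), $O(A^\delta)$ open elements (joins of subsets of $A$); $J^\infty(A^\delta)$, $M^\infty(A^\delta)$ the completely join-irreducible and completely meet-irreducible elements. A slanted $\mathcal{L}_{\mathrm{LE}}$-algebra $\mathbb{A}$ consists of $A$ and, for each $f\in\mathcal{F}$, a map $f:A^{\epsilon_f}\to A^\delta$ preserving finite (incl. empty) joins of $A^{\epsilon_f}$ in each coordinate with values in $K(A^\delta)$, and for each $g\in\mathcal{G}$ a map $g:A^{\epsilon_g}\to A^\delta$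 preserving finite (incl. empty) meets of $A^{\epsilon_g}$ in each coordinate with values in $O(A^\delta)$ (here $A^\epsilon=\prod_iA^{\epsilon(i)}$, $A^1=A$, $A^\partial$ the dual). In $A^\delta$, $f$ is interpreted by its $\sigma$-extension $f^\sigma$ and $g$ by its $\pi$-extension $g^\pi$ (for closed tuples $\overline{k}$, $f^\sigma(\overline{k})=\bigwedge\{f(\overline{a})\mid\overline{a}\in A^{\epsilon_f},\overline{k}\leq^{\epsilon_f}\overline{a}\}$, extended to all tuples as the join over closed tuples below; $g^\pi$ order-dually). Expanded language $\mathcal{L}^+_{\mathrm{LE}}$. For each $f\in\mathcal{F}$, $1\leq i\leq n_f$, add an $n_f$-ary $f^\sharp_i$, and for each $g\in\mathcal{G}$, $1\leq i\leq n_g$, an $n_g$-ary $g^\flat_i$; if $\epsilon_f(i)=1$ then $\epsilon_{f^\sharp_i}(i)=1$ and $\epsilon_{f^\sharp_i}(j)=\epsilon_f(j)^\partial$ for $j\neq i$, if $\epsilon_f(i)=\partial$ then $\epsilon_{f^\sharp_i}=\epsilon_f$; same rule for $g^\flat_i$. $\mathcal{F}^*=\mathcal{F}\cup\{f^\sharp_i\mid\epsilon_f(i)=\partial\}\cup\{g^\flat_i\mid\epsilon_g(i)=1\}$, $\mathcal{G}^*=\mathcal{G}\cup\{f^\sharp_i\mid\epsilon_f(i)=1\}\cup\{g^\flat_i\mid\epsilon_g(i)=\partial\}$. Add nominals $\mathbf{j}$ and co-nominals $\mathbf{m}$. Terms: $\phi::=\mathbf{j}\mid\mathbf{m}\mid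 p\mid\top\mid\bot\mid\phi\wedge\phi\mid\phi\vee\phi\mid h(\overline{\phi})$, $h\in\mathcal{F}^*\cup\mathcal{G}^*$. In $A^\delta$: $f^\sigma(u_1,\ldots,u_i,\ldots,u_n)\leq w$ iff $u_i\leq f^\sharp_i(u_1,\ldots,w,\ldots,u_n)$ if $\epsilon_f(i)=1$, resp. iff $u_i\geq f^\sharp_i(u_1,\ldots,w,\ldots,u_n)$ if $\epsilon_f(i)=\partial$; $w\leq g^\pi(u_1,\ldots,u_i,\ldots,u_n)$ iff $g^\flat_i(u_1,\ldots,w,\ldots,u_n)\leq u_i$ if $\epsilon_g(i)=1$, resp. $\geq u_i$ if $\epsilon_g(i)=\partial$. An admissible assignment sends propositional variables into $A$, nominals into $J^\infty(A^\delta)$, co-nominals into $M^\infty(A^\delta)$; $(\mathbb{A},v)\models\phi\leq\psi$ means $\phi(v)\leq\psi(v)$ in $A^\delta$. Writing $h(\overline{\phi},\overline{\psi})$ with $\overline{\phi}$ in coordinates with $\epsilon_h(i)=1$ and $\overline{\psi}$ in those with $\epsilon_h(i)=\partial$: ssc $::=p\mid\mathbf{j}\mid\top\mid\bot\mid\phi\vee\phi\mid\phi\wedge\phi\mid f^*(\overline{\phi},\overline{\psi})$ ($f^*\in\mathcal{F}^*$, $\overline{\phi}$ ssc, $\overline{\psi}$ sso); sso $::=p\mid\mathbf{m}\mid\top\mid\bot\mid\psi\vee\psi\mid\psi\wedge\psi\mid g^*(\overline{\psi},\overline{\phi})$ ($g^*\in\mathcal{G}^*$, $\overline{\psi}$ sso,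 $\overline{\phi}$ ssc). A term is positive (negative) in $p$ if every occurrence of $p$ in its positive signed generation tree has sign $+$ ($-$), signs being propagated unchanged through $\wedge,\vee$ and coordinates of order-type $1$ and flipped through coordinates of order-type $\partial$. -}

module Defs where

open import Level using (0ℓ)
import Data.Nat
open import Data.Nat using (ℕ)
open import Data.Fin using (Fin; _≟_)
open import Data.List using (List; foldr)
open import Data.List.Relation.Unary.All using (All)
open import Data.Product using (Σ; _×_; _,_)
open import Data.Sum using (_⊎_)
open import Data.Empty using (⊥)
open import Data.Unit using (⊤)
open import Relation.Nullary using (¬_; yes; no)
open import Relation.Binary using (Rel; IsPartialOrder)
open import Relation.Binary.PropositionalEquality using (_≡_)
open import Relation.Binary.Lattice.Bundles using (BoundedLattice)

data Pol : Set where
  one ∂ : Pol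

-- LE-signatures: F and G are disjoint since they are separate types.

record Signature : Set₁ where
  field
    FConn GConn : Set
    arF : FConn → ℕ
    arG : GConn → ℕ
    εF  : (f : FConn) → Fin (arF f) → Pol
    εG  : (g : GConn) → Fin (arG g) → Pol

record CompleteLattice : Set₁ where
  infix 4 _≈_ _≤_
  field
    Carrier : Set
    _≈_ : Rel Carrier 0ℓ
    _≤_ : Rel Carrier 0ℓ
    isPartialOrder : IsPartialOrder _≈_ _≤_
    ⋀ ⋁ : (Carrier → Set) → Carrier
    ⋀-lb  : ∀ P x → P x → ⋀ P ≤ x
    ⋀-glb : ∀ P y → (∀ x → P x → y ≤ x) → y ≤ ⋀ P
    ⋁-ub  : ∀ P x → P x → x ≤ ⋁ P
    ⋁-lub : ∀ P y → (∀ x → P x → x ≤ y) → ⋁ P ≤ y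

  ⊤c ⊥c : Carrier
  ⊤c = ⋀ (λ _ → ⊥)
  ⊥c = ⋁ (λ _ → ⊥)
  _∧c_ _∨c_ : Carrier → Carrier → Carrier
  x ∧c y = ⋀ (λ z → z ≡ x ⊎ z ≡ y)
  x ∨c y = ⋁ (λ z → z ≡ x ⊎ z ≡ y)

  JoinIrr : Carrier → Set₁
  JoinIrr j = ∀ (S : Carrier → Set) → j ≈ ⋁ S → Σ Carrier (λ x → S x × x ≈ j)
  MeetIrr : Carrier → Set₁
  MeetIrr m = ∀ (S : Carrier → Set) → m ≈ ⋀ S → Σ Carrier (λ x → S x × x ≈ m)

BL : Set₁
BL = BoundedLattice 0ℓ 0ℓ 0ℓ

record Embedding (A : BL) : Set₁ where
  module A = BoundedLattice A
  field
    C : CompleteLattice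
  open CompleteLattice C
  field
    e : A.Carrier → Carrier
    e-mono   : ∀ {a b} → a A.≤ b → e a ≤ e b
    e-refl   : ∀ {a b} → e a ≤ e b → a A.≤ b
    e-∧ : ∀ a b → e (a A.∧ b) ≈ (e a ∧c e b)
    e-∨ : ∀ a b → e (a A.∨ b) ≈ (e a ∨c e b)
    e-⊤ : e A.⊤ ≈ ⊤c
    e-⊥ : e A.⊥ ≈ ⊥c

module EmbeddingOps {A : BL} (E : Embedding A) where
  open Embedding E
  open CompleteLattice C

  img : (A.Carrier → Set) → Carrier → Set
  img S x = Σ A.Carrier (λ a → S a × x ≈ e a)

  -- closed elements (meets of subsets of A) and open elements (joins of
  -- subsets of A).  u is a meet of some subset of A iff it is the meet of
  -- the subset {a ∈ A | u ≤ a} (dually for joins); we use this canonical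
  -- subset to stay in Set.
  Closed Open : Carrier → Set
  Closed u = u ≈ ⋀ (img (λ a → u ≤ e a))
  Open   u = u ≈ ⋁ (img (λ a → e a ≤ u))

record CanExt (A : BL) : Set₁ where
  field
    emb : Embedding A
  open Embedding emb public
  open CompleteLattice C
  open EmbeddingOps emb public
  field
    dense-K : ∀ u → u ≈ ⋁ (λ k → Closed k × k ≤ u)
    dense-O : ∀ u → u ≈ ⋀ (λ o → Open o × u ≤ o)
    compact : ∀ (S T : A.Carrier → Set) → ⋀ (img S) ≤ ⋁ (img T) →
      Σ (List A.Carrier) (λ xs → Σ (List A.Carrier) (λ ys →
        All S xs × All T ys × foldr A._∧_ A.⊤ xs A.≤ foldr A._∨_ A.⊥ ys))

upd : ∀ {X : Set} {n} → (Fin n → X) → Fin n → X → Fin n → X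
upd u i x j with j ≟ i
... | yes _ = x
... | no  _ = u j

-- the order of X^ε in one coordinate: X^1 = X, X^∂ the order dual
polLe : ∀ {X : Set} → Rel X 0ℓ → Pol → X → X → Set
polLe _≤_ one x y = x ≤ y
polLe _≤_ ∂   x y = y ≤ x

Leε : ∀ {X : Set} {n} → Rel X 0ℓ → (Fin n → Pol) → (Fin n → X) → (Fin n → X) → Set
Leε _≤_ ε u w = ∀ i → polLe _≤_ (ε i) (u i) (w i)

module _ {A : BL} (X : CanExt A) where
  open CanExt X
  open CompleteLattice C

  -- closed (resp. open) elements of (A^δ)^ε, coordinatewise;
  -- closed elements of the dual lattice are the open elements.
  ClosedAt OpenAt : Pol → Carrier → Set
  ClosedAt one u = Closed u
  ClosedAt ∂   u = Open u
  OpenAt   one u = Open u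
  OpenAt   ∂   u = Closed u

  -- f preserves finite (incl. empty) joins of A^ε in coordinate i
  PresJoinAt : ∀ {n} → ((Fin n → A.Carrier) → Carrier) → Pol → Fin n → Set
  PresJoinAt h one i = (∀ a x y → h (upd a i (x A.∨ y)) ≈ (h (upd a i x) ∨c h (upd a i y)))
                     × (∀ a → h (upd a i A.⊥) ≈ ⊥c)
  PresJoinAt h ∂   i = (∀ a x y → h (upd a i (x A.∧ y)) ≈ (h (upd a i x) ∨c h (upd a i y)))
                     × (∀ a → h (upd a i A.⊤) ≈ ⊥c)

  -- g preserves finite (incl. empty) meets of A^ε in coordinate i
  PresMeetAt : ∀ {n} → ((Fin n → A.Carrier) → Carrier) → Pol → Fin n → Set
  PresMeetAt h one i = (∀ a x y → h (upd a i (x A.∧ y)) ≈ (h (upd a i x) ∧c h (upd a i y)))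
                     × (∀ a → h (upd a i A.⊤) ≈ ⊤c)
  PresMeetAt h ∂   i = (∀ a x y → h (upd a i (x A.∨ y)) ≈ (h (upd a i x) ∧c h (upd a i y)))
                     × (∀ a → h (upd a i A.⊥) ≈ ⊤c)

  Cong : ∀ {n} → ((Fin n → A.Carrier) → Carrier) → Set
  Cong h = ∀ a b → (∀ i → a i A.≈ b i) → h a ≈ h b

record Slanted (Sig : Signature) (A : BL) (X : CanExt A) : Set₁ where
  open Signature Sig
  open CanExt X
  field
    fA : (f : FConn) → (Fin (arF f) → A.Carrier) → CompleteLattice.Carrier C
    gA : (g : GConn) → (Fin (arG g) → A.Carrier) → CompleteLattice.Carrier C
    fA-cong   : ∀ f → Cong X (fA f)
    gA-cong   : ∀ g → Cong X (gA g)
    fA-closed : ∀ f a → Closed (fA f a)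
    gA-open   : ∀ g a → Open (gA g a)
    fA-join   : ∀ f i → PresJoinAt X (fA f) (εF f i) i
    gA-meet   : ∀ g i → PresMeetAt X (gA g) (εG g i) i

module Ext {Sig : Signature} {A : BL} (X : CanExt A) (𝔸 : Slanted Sig A X) where
  open Signature Sig
  open CanExt X
  open CompleteLattice C
  open Slanted 𝔸

  ClosedTuple OpenTuple : ∀ {n} → (Fin n → Pol) → (Fin n → Carrier) → Set
  ClosedTuple ε k = ∀ i → ClosedAt X (ε i) (k i)
  OpenTuple   ε o = ∀ i → OpenAt X (ε i) (o i)

  fσK : (f : FConn) → (Fin (arF f) → Carrier) → Carrier
  fσK f k = ⋀ (λ x → Σ (Fin (arF f) → A.Carrier) (λ a →
              Leε _≤_ (εF f) k (λ i → e (a i)) × x ≈ fA f a))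

  fσ : (f : FConn) → (Fin (arF f) → Carrier) → Carrier
  fσ f u = ⋁ (λ x → Σ (Fin (arF f) → Carrier) (λ k →
             ClosedTuple (εF f) k × Leε _≤_ (εF f) k u × x ≈ fσK f k))

  gπO : (g : GConn) → (Fin (arG g) → Carrier) → Carrier
  gπO g o = ⋁ (λ x → Σ (Fin (arG g) → A.Carrier) (λ a →
              Leε _≤_ (εG g) (λ i → e (a i)) o × x ≈ gA g a))

  gπ : (g : GConn) → (Fin (arG g) → Carrier) → Carrier
  gπ g u = ⋀ (λ x → Σ (Fin (arG g) → Carrier) (λ o →
             OpenTuple (εG g) o × Leε _≤_ (εG g) u o × x ≈ gπO g o))

  -- residuals.  f♯ᵢ(u₁,…,w,…,uₙ) (w in coordinate i) is the unique element with
  --   f^σ(u₁,…,uᵢ,…,uₙ) ≤ w  iff  uᵢ ≤ f♯ᵢ(u₁,…,w,…,uₙ)   (εf(i) = 1)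
  --   f^σ(u₁,…,uᵢ,…,uₙ) ≤ w  iff  uᵢ ≥ f♯ᵢ(u₁,…,w,…,uₙ)   (εf(i) = ∂)
  -- and g♭ᵢ order-dually; in a complete lattice it is given by the
  -- following join/meet.
  ⋁⋀ ⋀⋁ : Pol → (Carrier → Set) → Carrier
  ⋁⋀ one = ⋁
  ⋁⋀ ∂   = ⋀
  ⋀⋁ one = ⋀
  ⋀⋁ ∂   = ⋁

  f♯ : (f : FConn) → Fin (arF f) → (Fin (arF f) → Carrier) → Carrier
  f♯ f i u = ⋁⋀ (εF f i) (λ x → fσ f (upd u i x) ≤ u i)

  g♭ : (g : GConn) → Fin (arG g) → (Fin (arG g) → Carrier) → Carrier
  g♭ g i u = ⋀⋁ (εG g i) (λ x → u i ≤ gπ g (upd u i x))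

flip : Pol → Pol
flip one = ∂
flip ∂   = one

data Kind : Set where
  isF isG : Kind

module Syntax (Sig : Signature) where
  open Signature Sig

  data Conn : Set where
    fc  : FConn → Conn
    gc  : GConn → Conn
    fsh : (f : FConn) → Fin (arF f) → Conn
    gfl : (g : GConn) → Fin (arG g) → Conn

  arity : Conn → ℕ
  arity (fc f)    = arF f
  arity (gc g)    = arG g
  arity (fsh f _) = arF f
  arity (gfl g _) = arG g

  εres : ∀ {n} → Fin n → (Fin n → Pol) → Fin n → Pol
  εres i ε j with ε i | j ≟ i
  ... | one | yes _ = one
  ... | one | no  _ = flip (ε j)
  ... | ∂   | _     = ε j

  εC : (h : Conn) → Fin (arity h) → Pol
  εC (fc f)    = εF f
  εC (gc g)    = εG g
  εC (fsh f i) = εres i (εF f)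
  εC (gfl g i) = εres i (εG g)

  kindAt : Pol → Kind → Kind → Kind
  kindAt one k₁ _ = k₁
  kindAt ∂   _ k₂ = k₂

  kind : Conn → Kind
  kind (fc _)    = isF
  kind (gc _)    = isG
  kind (fsh f i) = kindAt (εF f i) isG isF
  kind (gfl g i) = kindAt (εG g i) isF isG

  data Term : Set where
    var   : ℕ → Term
    nom   : ℕ → Term
    conom : ℕ → Term
    ⊤t ⊥t : Term
    _∧t_ _∨t_ : Term → Term → Term
    app   : (h : Conn) → (Fin (arity h) → Term) → Term

  data SSC : Term → Set
  data SSO : Term → Set
  -- argument of a coordinate of order type 1 (resp. ∂) of an F*-connective
  data ArgC : Pol → Term → Set
  -- argument of a coordinate of order type 1 (resp. ∂) of a G*-connective
  data ArgO : Pol → Term → Set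

  data SSC where
    var : ∀ p → SSC (var p)
    nom : ∀ j → SSC (nom j)
    ⊤t  : SSC ⊤t
    ⊥t  : SSC ⊥t
    _∨t_ : ∀ {φ ψ} → SSC φ → SSC ψ → SSC (φ ∨t ψ)
    _∧t_ : ∀ {φ ψ} → SSC φ → SSC ψ → SSC (φ ∧t ψ)
    app : ∀ h ts → kind h ≡ isF → (∀ i → ArgC (εC h i) (ts i)) → SSC (app h ts)

  data SSO where
    var   : ∀ p → SSO (var p)
    conom : ∀ m → SSO (conom m)
    ⊤t  : SSO ⊤t
    ⊥t  : SSO ⊥t
    _∨t_ : ∀ {φ ψ} → SSO φ → SSO ψ → SSO (φ ∨t ψ)
    _∧t_ : ∀ {φ ψ} → SSO φ → SSO ψ → SSO (φ ∧t ψ)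
    app : ∀ h ts → kind h ≡ isG → (∀ i → ArgO (εC h i) (ts i)) → SSO (app h ts)

  data ArgC where
    one : ∀ {φ} → SSC φ → ArgC one φ
    ∂   : ∀ {ψ} → SSO ψ → ArgC ∂ ψ

  data ArgO where
    one : ∀ {ψ} → SSO ψ → ArgO one ψ
    ∂   : ∀ {φ} → SSC φ → ArgO ∂ φ

  -- positivity / negativity in p (signs in the positive signed generation tree)
  PosIn NegIn : ℕ → Term → Set
  SignAt : Pol → ℕ → Term → Set

  PosIn p (var q)   = ⊤
  PosIn p (nom _)   = ⊤
  PosIn p (conom _) = ⊤
  PosIn p ⊤t        = ⊤
  PosIn p ⊥t        = ⊤
  PosIn p (φ ∧t ψ)  = PosIn p φ × PosIn p ψ
  PosIn p (φ ∨t ψ)  = PosIn p φ × PosIn p ψ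
  PosIn p (app h ts) = ∀ i → SignAt (εC h i) p (ts i)

  NegIn p (var q)   = ¬ (q ≡ p)
  NegIn p (nom _)   = ⊤
  NegIn p (conom _) = ⊤
  NegIn p ⊤t        = ⊤
  NegIn p ⊥t        = ⊤
  NegIn p (φ ∧t ψ)  = NegIn p φ × NegIn p ψ
  NegIn p (φ ∨t ψ)  = NegIn p φ × NegIn p ψ
  NegIn p (app h ts) = ∀ i → SignAt (flip (εC h i)) p (ts i)

  SignAt one p t = PosIn p t
  SignAt ∂   p t = NegIn p t

  NoOcc : ℕ → Term → Set
  NoOcc p (var q)   = ¬ (q ≡ p)
  NoOcc p (nom _)   = ⊤
  NoOcc p (conom _) = ⊤
  NoOcc p ⊤t        = ⊤
  NoOcc p ⊥t        = ⊤
  NoOcc p (φ ∧t ψ)  = NoOcc p φ × NoOcc p ψ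
  NoOcc p (φ ∨t ψ)  = NoOcc p φ × NoOcc p ψ
  NoOcc p (app h ts) = ∀ i → NoOcc p (ts i)

  _[_/_] : Term → Term → ℕ → Term
  var q [ α / p ] with q Data.Nat.≟ p
  ... | yes _ = α
  ... | no  _ = var q
  nom j [ α / p ]    = nom j
  conom m [ α / p ]  = conom m
  ⊤t [ α / p ]       = ⊤t
  ⊥t [ α / p ]       = ⊥t
  (φ ∧t ψ) [ α / p ] = (φ [ α / p ]) ∧t (ψ [ α / p ])
  (φ ∨t ψ) [ α / p ] = (φ [ α / p ]) ∨t (ψ [ α / p ])
  app h ts [ α / p ] = app h (λ i → ts i [ α / p ])

module Sem {Sig : Signature} {A : BL} (X : CanExt A) (𝔸 : Slanted Sig A X) where
  open Signature Sig
  open CanExt X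
  open CompleteLattice C
  open Ext X 𝔸
  open Syntax Sig

  record Assignment : Set₁ where
    field
      valP : ℕ → A.Carrier
      valN : ℕ → Carrier
      valM : ℕ → Carrier
      valN-irr : ∀ j → JoinIrr (valN j)
      valM-irr : ∀ m → MeetIrr (valM m)
  open Assignment public

  DiffAtMost : ℕ → Assignment → Assignment → Set
  DiffAtMost p v v' = (∀ q → ¬ (q ≡ p) → valP v' q ≡ valP v q)
                    × (∀ j → valN v' j ≡ valN v j)
                    × (∀ m → valM v' m ≡ valM v m)

  interp : (h : Conn) → (Fin (arity h) → Carrier) → Carrier
  interp (fc f)    = fσ f
  interp (gc g)    = gπ g
  interp (fsh f i) = f♯ f i
  interp (gfl g i) = g♭ g i

  ⟦_⟧ : Term → Assignment → Carrier
  ⟦ var p ⟧ v    = e (valP v p)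
  ⟦ nom j ⟧ v    = valN v j
  ⟦ conom m ⟧ v  = valM v m
  ⟦ ⊤t ⟧ v       = ⊤c
  ⟦ ⊥t ⟧ v       = ⊥c
  ⟦ φ ∧t ψ ⟧ v   = ⟦ φ ⟧ v ∧c ⟦ ψ ⟧ v
  ⟦ φ ∨t ψ ⟧ v   = ⟦ φ ⟧ v ∨c ⟦ ψ ⟧ v
  ⟦ app h ts ⟧ v = interp h (λ i → ⟦ ts i ⟧ v)

  _⊨_≤t_ : Assignment → Term → Term → Set
  v ⊨ φ ≤t ψ = ⟦ φ ⟧ v ≤ ⟦ ψ ⟧ v

module Submission where

-- Write O for the value of α; it is open, as α is strictly syntactically open and
-- free of p. The heart of the proof is an invariant established by induction on
-- terms: a strictly syntactically closed term β negative in p, read as a function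
-- β(x) of the value x of p, has a closed value β(O), and every upper bound b ∈ A of
-- β(O) already bounds β(d) for all d ∈ A with d₀ ≤ d ≤ O, for some d₀ ≤ O in A;
-- dually for strictly syntactically open terms positive in p. Compactness of A^δ
-- drives every case: σ- and π-extensions at closed (open) tuples are reached through
-- finitely many values of the maps on A, and the residuals are joins (meets) whose
-- closed (open) members are dominated by members from A.
-- If β(O) ≤ γ(O), interpolate c ∈ A between them; the two invariants give a single
-- d ≤ O in A with β(d) ≤ γ(d), and v' sends p to d. Conversely,
-- β(α) ≤ β(p) ≤ γ(p) ≤ γ(α) by antitonicity of β and monotonicity of γ in p.

open import Defs
open import Level using (0ℓ)
open import Data.Nat using (ℕ; zero; suc)
import Data.Nat as ℕ
open import Data.Fin using (Fin; zero; suc; _≟_)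
open import Data.List using (List; []; _∷_; foldr)
open import Data.Vec.Functional using (tail) renaming (_∷_ to _∷ᵛ_)
open import Data.List.Relation.Unary.All using (All; []; _∷_)
import Data.List.Relation.Unary.All as All
open import Data.Product using (Σ; _×_; _,_; proj₁; proj₂)
open import Data.Sum using (_⊎_; inj₁; inj₂)
open import Data.Empty using (⊥-elim)
open import Data.Unit using (tt)
open import Function.Bundles using (_⇔_; mk⇔)
open import Relation.Nullary using (Dec; yes; no)
open import Relation.Binary using (Rel; Reflexive; Transitive)
open import Relation.Binary.Bundles using (Poset)
open import Relation.Binary.PropositionalEquality
  using (_≡_; _≢_; refl; sym; trans; subst; cong)
import Relation.Binary.Lattice.Properties.MeetSemilattice as MeetSemilatticeProperties
import Relation.Binary.Lattice.Properties.JoinSemilattice as JoinSemilatticeProperties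
import Relation.Binary.Reasoning.PartialOrder as PartialOrderReasoning

module _ {X : Set} {n : ℕ} (u : Fin n → X) (i : Fin n) (x : X) where

  upd-at : upd u i x i ≡ x
  upd-at with i ≟ i
  ... | yes _   = refl
  ... | no i≢i = ⊥-elim (i≢i refl)

  upd-other : ∀ {j} → j ≢ i → upd u i x j ≡ u j
  upd-other {j} j≢i with j ≟ i
  ... | yes j≡i = ⊥-elim (j≢i j≡i)
  ... | no _    = refl

  upd-pointwise : (P : Fin n → X → Set) → P i x → (∀ j → j ≢ i → P j (u j)) →
                  ∀ j → P j (upd u i x j)
  upd-pointwise P Pix Pu j with j ≟ i
  ... | yes refl = Pix
  ... | no j≢i   = Pu j j≢i

upd-self : ∀ {X : Set} {n} (u : Fin n → X) i j → upd u i (u i) j ≡ u j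
upd-self u i j with j ≟ i
... | yes refl = refl
... | no _     = refl

module _ {X : Set} {R : Rel X 0ℓ} {n} (ε : Fin n → Pol) where

  upd-mono : ∀ {u u' : Fin n → X} i {y y'} → polLe R (ε i) y y' →
             (∀ j → j ≢ i → polLe R (ε j) (u j) (u' j)) → Leε R ε (upd u i y) (upd u' i y')
  upd-mono i y≤y' u≤u' j with j ≟ i
  ... | yes refl = y≤y'
  ... | no j≢i   = u≤u' j j≢i

  module _ (u w : Fin n → X) (i : Fin n) (y : X) where

    upd-≤ε : polLe R (ε i) y (w i) → (∀ j → j ≢ i → polLe R (ε j) (u j) (w j)) →
             Leε R ε (upd u i y) w
    upd-≤ε = upd-pointwise u i y (λ j z → polLe R (ε j) z (w j))

    ≤ε-upd : polLe R (ε i) (w i) y → (∀ j → j ≢ i → polLe R (ε j) (w j) (u j)) →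
             Leε R ε w (upd u i y)
    ≤ε-upd = upd-pointwise u i y (λ j z → polLe R (ε j) (w j) z)

    upd-≤ε-at : Leε R ε (upd u i y) w → polLe R (ε i) y (w i)
    upd-≤ε-at le = subst (λ z → polLe R (ε i) z (w i)) (upd-at u i y) (le i)

    upd-≤ε-other : Leε R ε (upd u i y) w → ∀ j → j ≢ i → polLe R (ε j) (u j) (w j)
    upd-≤ε-other le j j≢i = subst (λ z → polLe R (ε j) z (w j)) (upd-other u i y j≢i) (le j)

    ≤ε-upd-at : Leε R ε w (upd u i y) → polLe R (ε i) (w i) y
    ≤ε-upd-at le = subst (λ z → polLe R (ε i) (w i) z) (upd-at u i y) (le i)

    ≤ε-upd-other : Leε R ε w (upd u i y) → ∀ j → j ≢ i → polLe R (ε j) (w j) (u j)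
    ≤ε-upd-other le j j≢i = subst (λ z → polLe R (ε j) (w j) z) (upd-other u i y j≢i) (le j)

module _ {X : Set} {_≤_ : Rel X 0ℓ} where

  polLe-refl : Reflexive _≤_ → ∀ π {x} → polLe _≤_ π x x
  polLe-refl refl′ one = refl′
  polLe-refl refl′ ∂   = refl′

  polLe-trans : Transitive _≤_ → ∀ π {x y z} →
                polLe _≤_ π x y → polLe _≤_ π y z → polLe _≤_ π x z
  polLe-trans trans′ one x≤y y≤z = trans′ x≤y y≤z
  polLe-trans trans′ ∂   y≤x z≤y = trans′ z≤y y≤x

  polLe-flip : ∀ π {x y} → polLe _≤_ (flip π) x y → polLe _≤_ π y x
  polLe-flip one le = le
  polLe-flip ∂   le = le

module CompleteLatticeProperties (L : CompleteLattice) where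
  open CompleteLattice L

  poset : Poset 0ℓ 0ℓ 0ℓ
  poset = record { isPartialOrder = isPartialOrder }

  open Poset poset public
    using (module Eq)
    renaming (refl to ≤-refl; trans to ≤-trans; antisym to ≤-antisym; reflexive to ≈⇒≤)

  ≈⇒≥ : ∀ {x y} → x ≈ y → y ≤ x
  ≈⇒≥ x≈y = ≈⇒≤ (Eq.sym x≈y)

  x∧y≤x : ∀ {x y} → x ∧c y ≤ x
  x∧y≤x {x} = ⋀-lb _ x (inj₁ refl)

  x∧y≤y : ∀ {x y} → x ∧c y ≤ y
  x∧y≤y {y = y} = ⋀-lb _ y (inj₂ refl)

  ∧-greatest : ∀ {x y z} → z ≤ x → z ≤ y → z ≤ x ∧c y
  ∧-greatest z≤x z≤y = ⋀-glb _ _ λ { _ (inj₁ refl) → z≤x ; _ (inj₂ refl) → z≤y }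

  x≤x∨y : ∀ {x y} → x ≤ x ∨c y
  x≤x∨y {x} = ⋁-ub _ x (inj₁ refl)

  y≤x∨y : ∀ {x y} → y ≤ x ∨c y
  y≤x∨y {y = y} = ⋁-ub _ y (inj₂ refl)

  ∨-least : ∀ {x y z} → x ≤ z → y ≤ z → x ∨c y ≤ z
  ∨-least x≤z y≤z = ⋁-lub _ _ λ { _ (inj₁ refl) → x≤z ; _ (inj₂ refl) → y≤z }

  ⊤-maximum : ∀ {x} → x ≤ ⊤c
  ⊤-maximum = ⋀-glb _ _ (λ _ ())

  ⊥-minimum : ∀ {x} → ⊥c ≤ x
  ⊥-minimum = ⋁-lub _ _ (λ _ ())

  ∧-mono : ∀ {x y x' y'} → x ≤ x' → y ≤ y' → x ∧c y ≤ x' ∧c y'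
  ∧-mono x≤x' y≤y' = ∧-greatest (≤-trans x∧y≤x x≤x') (≤-trans x∧y≤y y≤y')

  ∨-mono : ∀ {x y x' y'} → x ≤ x' → y ≤ y' → x ∨c y ≤ x' ∨c y'
  ∨-mono x≤x' y≤y' = ∨-least (≤-trans x≤x' x≤x∨y) (≤-trans y≤y' y≤x∨y)

  ∧-cong : ∀ {x y x' y'} → x ≈ x' → y ≈ y' → x ∧c y ≈ x' ∧c y'
  ∧-cong x≈x' y≈y' =
    ≤-antisym (∧-mono (≈⇒≤ x≈x') (≈⇒≤ y≈y')) (∧-mono (≈⇒≥ x≈x') (≈⇒≥ y≈y'))

  ∨-cong : ∀ {x y x' y'} → x ≈ x' → y ≈ y' → x ∨c y ≈ x' ∨c y'
  ∨-cong x≈x' y≈y' =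
    ≤-antisym (∨-mono (≈⇒≤ x≈x') (≈⇒≤ y≈y')) (∨-mono (≈⇒≥ x≈x') (≈⇒≥ y≈y'))

  ⋁-mono : ∀ {P Q : Carrier → Set} → (∀ x → P x → Q x) → ⋁ P ≤ ⋁ Q
  ⋁-mono P⊆Q = ⋁-lub _ _ λ x Px → ⋁-ub _ x (P⊆Q x Px)

  ⋀-antitone : ∀ {P Q : Carrier → Set} → (∀ x → P x → Q x) → ⋀ Q ≤ ⋀ P
  ⋀-antitone P⊆Q = ⋀-glb _ _ λ x Px → ⋀-lb _ x (P⊆Q x Px)

  ≡⇒≈ : ∀ {x y} → x ≡ y → x ≈ y
  ≡⇒≈ refl = Eq.refl

  ≈⇒polLe : ∀ π {x y} → x ≈ y → polLe _≤_ π x y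
  ≈⇒polLe one = ≈⇒≤
  ≈⇒polLe ∂   = ≈⇒≥

  polLe-≤-refl : ∀ π {x} → polLe _≤_ π x x
  polLe-≤-refl = polLe-refl ≤-refl

  Leε-refl : ∀ {n} (ε : Fin n → Pol) {u} → Leε _≤_ ε u u
  Leε-refl ε j = polLe-≤-refl (ε j)

  Leε-trans : ∀ {n} (ε : Fin n → Pol) {u v w} →
              Leε _≤_ ε u v → Leε _≤_ ε v w → Leε _≤_ ε u w
  Leε-trans ε u≤v v≤w j = polLe-trans ≤-trans (ε j) (u≤v j) (v≤w j)

module CanExtProperties {A : BL} (X : CanExt A) where
  open CanExt X public
  open CompleteLattice C public
  open CompleteLatticeProperties C public
  open MeetSemilatticeProperties A.meetSemilattice using (∧-monotonic)
  open JoinSemilatticeProperties A.joinSemilattice using (∨-monotonic)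

  ≤-e⊤ : ∀ {x} → x ≤ e A.⊤
  ≤-e⊤ = ≤-trans ⊤-maximum (≈⇒≥ e-⊤)

  e⊥-≤ : ∀ {x} → e A.⊥ ≤ x
  e⊥-≤ = ≤-trans (≈⇒≤ e-⊥) ⊥-minimum

  e-∧-greatest : ∀ {x a b} → x ≤ e a → x ≤ e b → x ≤ e (a A.∧ b)
  e-∧-greatest x≤a x≤b = ≤-trans (∧-greatest x≤a x≤b) (≈⇒≥ (e-∧ _ _))

  e-∨-least : ∀ {x a b} → e a ≤ x → e b ≤ x → e (a A.∨ b) ≤ x
  e-∨-least a≤x b≤x = ≤-trans (≈⇒≤ (e-∨ _ _)) (∨-least a≤x b≤x)

  meetList joinList : List A.Carrier → A.Carrier
  meetList = foldr A._∧_ A.⊤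
  joinList = foldr A._∨_ A.⊥

  ≤-e-meetList : ∀ {y} {P : A.Carrier → Set} → (∀ a → P a → y ≤ e a) →
                 ∀ {xs} → All P xs → y ≤ e (meetList xs)
  ≤-e-meetList y≤P []         = ≤-e⊤
  ≤-e-meetList y≤P (Px ∷ Pxs) = e-∧-greatest (y≤P _ Px) (≤-e-meetList y≤P Pxs)

  e-joinList-≤ : ∀ {y} {P : A.Carrier → Set} → (∀ a → P a → e a ≤ y) →
                 ∀ {xs} → All P xs → e (joinList xs) ≤ y
  e-joinList-≤ P≤y []         = e⊥-≤
  e-joinList-≤ P≤y (Px ∷ Pxs) = e-∨-least (P≤y _ Px) (e-joinList-≤ P≤y Pxs)

  ⋀img-lb : ∀ {S : A.Carrier → Set} {a} → S a → ⋀ (img S) ≤ e a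
  ⋀img-lb {a = a} Sa = ⋀-lb _ (e a) (a , Sa , Eq.refl)

  ⋀img-glb : ∀ {S : A.Carrier → Set} {y} → (∀ a → S a → y ≤ e a) → y ≤ ⋀ (img S)
  ⋀img-glb y≤S = ⋀-glb _ _ λ { x (a , Sa , x≈a) → ≤-trans (y≤S a Sa) (≈⇒≥ x≈a) }

  ⋁img-ub : ∀ {S : A.Carrier → Set} {a} → S a → e a ≤ ⋁ (img S)
  ⋁img-ub {a = a} Sa = ⋁-ub _ (e a) (a , Sa , Eq.refl)

  ⋁img-lub : ∀ {S : A.Carrier → Set} {y} → (∀ a → S a → e a ≤ y) → ⋁ (img S) ≤ y
  ⋁img-lub S≤y = ⋁-lub _ _ λ { x (a , Sa , x≈a) → ≤-trans (≈⇒≤ x≈a) (S≤y a Sa) }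

  compact-meet : ∀ (S : A.Carrier → Set) b → ⋀ (img S) ≤ e b →
                 Σ (List A.Carrier) λ xs → All S xs × e (meetList xs) ≤ e b
  compact-meet S b ⋀S≤b with compact S (_≡ b) (≤-trans ⋀S≤b (⋁img-ub refl))
  ... | xs , ys , Sxs , ys≡b , xs≤ys =
    xs , Sxs , ≤-trans (e-mono xs≤ys) (e-joinList-≤ (λ { _ refl → ≤-refl }) ys≡b)

  compact-join : ∀ (T : A.Carrier → Set) b → e b ≤ ⋁ (img T) →
                 Σ (List A.Carrier) λ ys → All T ys × e b ≤ e (joinList ys)
  compact-join T b b≤⋁T with compact (_≡ b) T (≤-trans (⋀img-lb refl) b≤⋁T)
  ... | xs , ys , xs≡b , Tys , xs≤ys =
    ys , Tys , ≤-trans (≤-e-meetList (λ { _ refl → ≤-refl }) xs≡b) (e-mono xs≤ys)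

  interpolate : ∀ {c o} → Closed c → Open o → c ≤ o → Σ A.Carrier λ a → c ≤ e a × e a ≤ o
  interpolate {c} {o} c-closed o-open c≤o
    with compact (λ a → c ≤ e a) (λ b → e b ≤ o)
                 (≤-trans (≈⇒≥ c-closed) (≤-trans c≤o (≈⇒≤ o-open)))
  ... | xs , ys , c≤xs , ys≤o , xs≤ys =
    meetList xs , ≤-e-meetList (λ _ le → le) c≤xs ,
    ≤-trans (e-mono xs≤ys) (e-joinList-≤ (λ _ le → le) ys≤o)

  interpolants⇒closed : ∀ {c} →
    (∀ o → Open o → c ≤ o → Σ A.Carrier λ a → c ≤ e a × e a ≤ o) → Closed c
  interpolants⇒closed {c} interp =
    ≤-antisym (⋀img-glb (λ _ le → le))
              (≤-trans (⋀-glb _ _ λ { o (o-open , c≤o) → between (interp o o-open c≤o) })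
                       (≈⇒≥ (dense-O c)))
    where
    between : ∀ {o} → Σ A.Carrier (λ a → c ≤ e a × e a ≤ o) → ⋀ (img (λ a → c ≤ e a)) ≤ o
    between (a , c≤a , a≤o) = ≤-trans (⋀img-lb c≤a) a≤o

  interpolants⇒open : ∀ {o} →
    (∀ k → Closed k → k ≤ o → Σ A.Carrier λ a → k ≤ e a × e a ≤ o) → Open o
  interpolants⇒open {o} interp =
    ≤-antisym (≤-trans (≈⇒≤ (dense-K o))
                       (⋁-lub _ _ λ { k (k-closed , k≤o) → between (interp k k-closed k≤o) }))
              (⋁img-lub (λ _ le → le))
    where
    between : ∀ {k} → Σ A.Carrier (λ a → k ≤ e a × e a ≤ o) → k ≤ ⋁ (img (λ a → e a ≤ o))
    between (a , k≤a , a≤o) = ≤-trans k≤a (⋁img-ub a≤o)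

  closed-resp-≈ : ∀ {c c'} → Closed c → c ≈ c' → Closed c'
  closed-resp-≈ c-closed c≈c' = interpolants⇒closed λ o o-open c'≤o →
    let (a , c≤a , a≤o) = interpolate c-closed o-open (≤-trans (≈⇒≤ c≈c') c'≤o)
    in a , ≤-trans (≈⇒≥ c≈c') c≤a , a≤o

  open-resp-≈ : ∀ {o o'} → Open o → o ≈ o' → Open o'
  open-resp-≈ o-open o≈o' = interpolants⇒open λ k k-closed k≤o' →
    let (a , k≤a , a≤o) = interpolate k-closed o-open (≤-trans k≤o' (≈⇒≥ o≈o'))
    in a , k≤a , ≤-trans a≤o (≈⇒≤ o≈o')

  closed-e : ∀ a → Closed (e a)
  closed-e a = interpolants⇒closed λ o _ a≤o → a , ≤-refl , a≤o

  open-e : ∀ a → Open (e a)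
  open-e a = interpolants⇒open λ k _ k≤a → a , k≤a , ≤-refl

  ⋀img-closed : ∀ (S : A.Carrier → Set) → Closed (⋀ (img S))
  ⋀img-closed S = ≤-antisym (⋀img-glb (λ _ le → le)) (⋀img-glb (λ a Sa → ⋀img-lb (⋀img-lb Sa)))

  ⋁img-open : ∀ (S : A.Carrier → Set) → Open (⋁ (img S))
  ⋁img-open S = ≤-antisym (⋁img-lub (λ a Sa → ⋁img-ub (⋁img-ub Sa))) (⋁img-lub (λ _ le → le))

  closed-⋀ : ∀ (P : Carrier → Set) → (∀ x → P x → Closed x) → Closed (⋀ P)
  closed-⋀ P closedP = ≤-antisym (⋀img-glb (λ _ le → le)) (⋀-glb _ _ λ x Px →
    ≤-trans (⋀-antitone λ _ → λ { (a , x≤a , eq) → a , ≤-trans (⋀-lb P x Px) x≤a , eq })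
            (≈⇒≥ (closedP x Px)))

  open-⋁ : ∀ (P : Carrier → Set) → (∀ x → P x → Open x) → Open (⋁ P)
  open-⋁ P openP = ≤-antisym (⋁-lub _ _ λ x Px →
    ≤-trans (≈⇒≤ (openP x Px))
            (⋁-mono λ _ → λ { (a , a≤x , eq) → a , ≤-trans a≤x (⋁-ub P x Px) , eq }))
    (⋁img-lub (λ _ le → le))

  closed-∧ : ∀ {x y} → Closed x → Closed y → Closed (x ∧c y)
  closed-∧ x-closed y-closed = closed-⋀ _ λ { _ (inj₁ refl) → x-closed ; _ (inj₂ refl) → y-closed }

  open-∨ : ∀ {x y} → Open x → Open y → Open (x ∨c y)
  open-∨ x-open y-open = open-⋁ _ λ { _ (inj₁ refl) → x-open ; _ (inj₂ refl) → y-open }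

  closed-∨ : ∀ {x y} → Closed x → Closed y → Closed (x ∨c y)
  closed-∨ x-closed y-closed = interpolants⇒closed λ o o-open x∨y≤o →
    let (a , x≤a , a≤o) = interpolate x-closed o-open (≤-trans x≤x∨y x∨y≤o)
        (b , y≤b , b≤o) = interpolate y-closed o-open (≤-trans y≤x∨y x∨y≤o)
    in a A.∨ b ,
       ∨-least (≤-trans x≤a (e-mono (A.x≤x∨y a b))) (≤-trans y≤b (e-mono (A.y≤x∨y a b))) ,
       e-∨-least a≤o b≤o

  open-∧ : ∀ {x y} → Open x → Open y → Open (x ∧c y)
  open-∧ x-open y-open = interpolants⇒open λ k k-closed k≤x∧y →
    let (a , k≤a , a≤x) = interpolate k-closed x-open (≤-trans k≤x∧y x∧y≤x)
        (b , k≤b , b≤y) = interpolate k-closed y-open (≤-trans k≤x∧y x∧y≤y)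
    in a A.∧ b , e-∧-greatest k≤a k≤b ,
       ∧-greatest (≤-trans (e-mono (A.x∧y≤x a b)) a≤x) (≤-trans (e-mono (A.x∧y≤y a b)) b≤y)

  closed-⊤ : Closed ⊤c
  closed-⊤ = closed-resp-≈ (closed-e A.⊤) e-⊤

  closed-⊥ : Closed ⊥c
  closed-⊥ = closed-resp-≈ (closed-e A.⊥) e-⊥

  open-⊤ : Open ⊤c
  open-⊤ = open-resp-≈ (open-e A.⊤) e-⊤

  open-⊥ : Open ⊥c
  open-⊥ = open-resp-≈ (open-e A.⊥) e-⊥

  joinIrr⇒closed : ∀ {j} → JoinIrr j → Closed j
  joinIrr⇒closed {j} irr with irr _ (dense-K j)
  ... | k , (k-closed , _) , k≈j = closed-resp-≈ k-closed k≈j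

  meetIrr⇒open : ∀ {m} → MeetIrr m → Open m
  meetIrr⇒open {m} irr with irr _ (dense-O m)
  ... | o , (o-open , _) , o≈m = open-resp-≈ o-open o≈m

  DownDirected UpDirected : (A.Carrier → Set) → Set
  DownDirected T = Σ A.Carrier T × (∀ x y → T x → T y → Σ A.Carrier λ z → T z × z A.≤ x A.∧ y)
  UpDirected   T = Σ A.Carrier T × (∀ x y → T x → T y → Σ A.Carrier λ z → T z × x A.∨ y A.≤ z)

  downDirected-lowerBound : ∀ {T} → DownDirected T → ∀ {xs} → All T xs →
                            Σ A.Carrier λ a → T a × a A.≤ meetList xs
  downDirected-lowerBound ((t , Tt) , _) [] = t , Tt , A.maximum t
  downDirected-lowerBound T-dir@(_ , lower) (Tx ∷ Txs) with downDirected-lowerBound T-dir Txs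
  ... | a , Ta , a≤xs with lower _ _ Tx Ta
  ... | z , Tz , z≤x∧a = z , Tz , A.trans z≤x∧a (∧-monotonic A.refl a≤xs)

  upDirected-upperBound : ∀ {T} → UpDirected T → ∀ {xs} → All T xs →
                          Σ A.Carrier λ a → T a × joinList xs A.≤ a
  upDirected-upperBound ((t , Tt) , _) [] = t , Tt , A.minimum t
  upDirected-upperBound T-dir@(_ , upper) (Tx ∷ Txs) with upDirected-upperBound T-dir Txs
  ... | a , Ta , xs≤a with upper _ _ Tx Ta
  ... | z , Tz , x∨a≤z = z , Tz , A.trans (∨-monotonic A.refl xs≤a) x∨a≤z

  compact-downDirected : ∀ {T} → DownDirected T → ∀ b → ⋀ (img T) ≤ e b →
                         Σ A.Carrier λ a → T a × a A.≤ b
  compact-downDirected T-dir b ⋀T≤b with compact-meet _ b ⋀T≤b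
  ... | xs , Txs , xs≤b with downDirected-lowerBound T-dir Txs
  ... | a , Ta , a≤xs = a , Ta , e-refl (≤-trans (e-mono a≤xs) xs≤b)

  compact-upDirected : ∀ {T} → UpDirected T → ∀ b → e b ≤ ⋁ (img T) →
                       Σ A.Carrier λ a → T a × b A.≤ a
  compact-upDirected T-dir b b≤⋁T with compact-join _ b b≤⋁T
  ... | xs , Txs , b≤xs with upDirected-upperBound T-dir Txs
  ... | a , Ta , xs≤a = a , Ta , e-refl (≤-trans b≤xs (e-mono xs≤a))

  MeetOfUpperBounds : Carrier → Carrier → A.Carrier → Set
  MeetOfUpperBounds c₁ c₂ a =
    Σ A.Carrier λ a₁ → Σ A.Carrier λ a₂ → c₁ ≤ e a₁ × c₂ ≤ e a₂ × a ≡ a₁ A.∧ a₂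

  JoinOfLowerBounds : Carrier → Carrier → A.Carrier → Set
  JoinOfLowerBounds o₁ o₂ a =
    Σ A.Carrier λ a₁ → Σ A.Carrier λ a₂ → e a₁ ≤ o₁ × e a₂ ≤ o₂ × a ≡ a₁ A.∨ a₂

  meetOfUpperBounds-downDirected : ∀ c₁ c₂ → DownDirected (MeetOfUpperBounds c₁ c₂)
  meetOfUpperBounds-downDirected c₁ c₂ =
    (A.⊤ A.∧ A.⊤ , A.⊤ , A.⊤ , ≤-e⊤ , ≤-e⊤ , refl) ,
    λ { _ _ (a₁ , a₂ , c₁≤a₁ , c₂≤a₂ , refl)
            (a₁' , a₂' , c₁≤a₁' , c₂≤a₂' , refl) →
          (a₁ A.∧ a₁') A.∧ (a₂ A.∧ a₂') ,
          (_ , _ , e-∧-greatest c₁≤a₁ c₁≤a₁' , e-∧-greatest c₂≤a₂ c₂≤a₂' , refl) ,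
          A.∧-greatest (∧-monotonic (A.x∧y≤x _ _) (A.x∧y≤x _ _))
                       (∧-monotonic (A.x∧y≤y _ _) (A.x∧y≤y _ _)) }

  joinOfLowerBounds-upDirected : ∀ o₁ o₂ → UpDirected (JoinOfLowerBounds o₁ o₂)
  joinOfLowerBounds-upDirected o₁ o₂ =
    (A.⊥ A.∨ A.⊥ , A.⊥ , A.⊥ , e⊥-≤ , e⊥-≤ , refl) ,
    λ { _ _ (a₁ , a₂ , a₁≤o₁ , a₂≤o₂ , refl)
            (a₁' , a₂' , a₁'≤o₁ , a₂'≤o₂ , refl) →
          (a₁ A.∨ a₁') A.∨ (a₂ A.∨ a₂') ,
          (_ , _ , e-∨-least a₁≤o₁ a₁'≤o₁ , e-∨-least a₂≤o₂ a₂'≤o₂ , refl) ,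
          A.∨-least (∨-monotonic (A.x≤x∨y _ _) (A.x≤x∨y _ _))
                    (∨-monotonic (A.y≤x∨y _ _) (A.y≤x∨y _ _)) }

  closed-∧-split : ∀ {c₁ c₂} b → Closed c₁ → Closed c₂ → c₁ ∧c c₂ ≤ e b →
    Σ A.Carrier λ b₁ → Σ A.Carrier λ b₂ → c₁ ≤ e b₁ × c₂ ≤ e b₂ × e b₁ ∧c e b₂ ≤ e b
  closed-∧-split {c₁} {c₂} b c₁-closed c₂-closed c₁∧c₂≤b
    with compact-downDirected (meetOfUpperBounds-downDirected c₁ c₂) b
                              (≤-trans ⋀≤c₁∧c₂ c₁∧c₂≤b)
    where
    ⋀≤c₁∧c₂ : ⋀ (img (MeetOfUpperBounds c₁ c₂)) ≤ c₁ ∧c c₂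
    ⋀≤c₁∧c₂ = ∧-greatest
      (≤-trans (⋀img-glb λ a₁ c₁≤a₁ →
                 ≤-trans (⋀img-lb (a₁ , A.⊤ , c₁≤a₁ , ≤-e⊤ , refl)) (e-mono (A.x∧y≤x _ _)))
               (≈⇒≥ c₁-closed))
      (≤-trans (⋀img-glb λ a₂ c₂≤a₂ →
                 ≤-trans (⋀img-lb (A.⊤ , a₂ , ≤-e⊤ , c₂≤a₂ , refl)) (e-mono (A.x∧y≤y _ _)))
               (≈⇒≥ c₂-closed))
  ... | _ , (b₁ , b₂ , c₁≤b₁ , c₂≤b₂ , refl) , b₁∧b₂≤b =
    b₁ , b₂ , c₁≤b₁ , c₂≤b₂ , ≤-trans (≈⇒≥ (e-∧ b₁ b₂)) (e-mono b₁∧b₂≤b)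

  open-∨-split : ∀ {o₁ o₂} b → Open o₁ → Open o₂ → e b ≤ o₁ ∨c o₂ →
    Σ A.Carrier λ b₁ → Σ A.Carrier λ b₂ → e b₁ ≤ o₁ × e b₂ ≤ o₂ × e b ≤ e b₁ ∨c e b₂
  open-∨-split {o₁} {o₂} b o₁-open o₂-open b≤o₁∨o₂
    with compact-upDirected (joinOfLowerBounds-upDirected o₁ o₂) b
                            (≤-trans b≤o₁∨o₂ o₁∨o₂≤⋁)
    where
    o₁∨o₂≤⋁ : o₁ ∨c o₂ ≤ ⋁ (img (JoinOfLowerBounds o₁ o₂))
    o₁∨o₂≤⋁ = ∨-least
      (≤-trans (≈⇒≤ o₁-open) (⋁img-lub λ a₁ a₁≤o₁ →
                 ≤-trans (e-mono (A.x≤x∨y _ _)) (⋁img-ub (a₁ , A.⊥ , a₁≤o₁ , e⊥-≤ , refl))))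
      (≤-trans (≈⇒≤ o₂-open) (⋁img-lub λ a₂ a₂≤o₂ →
                 ≤-trans (e-mono (A.y≤x∨y _ _)) (⋁img-ub (A.⊥ , a₂ , e⊥-≤ , a₂≤o₂ , refl))))
  ... | _ , (b₁ , b₂ , b₁≤o₁ , b₂≤o₂ , refl) , b≤b₁∨b₂ =
    b₁ , b₂ , b₁≤o₁ , b₂≤o₂ , ≤-trans (e-mono b≤b₁∨b₂) (≈⇒≤ (e-∨ b₁ b₂))

  Eventually : Carrier → (A.Carrier → Set) → Set
  Eventually O P = Σ A.Carrier λ d → e d ≤ O × (∀ d' → d A.≤ d' → e d' ≤ O → P d')

  module _ {O : Carrier} where

    eventually-always : ∀ {P : A.Carrier → Set} → (∀ d → P d) → Eventually O P
    eventually-always P = A.⊥ , e⊥-≤ , λ d _ _ → P d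

    eventually-map : ∀ {P Q : A.Carrier → Set} → (∀ d → P d → Q d) →
                     Eventually O P → Eventually O Q
    eventually-map P⇒Q (d , d≤O , P↑) = d , d≤O , λ d' d≤d' d'≤O → P⇒Q d' (P↑ d' d≤d' d'≤O)

    eventually-× : ∀ {P Q : A.Carrier → Set} →
                   Eventually O P → Eventually O Q → Eventually O (λ d → P d × Q d)
    eventually-× (d₁ , d₁≤O , P↑) (d₂ , d₂≤O , Q↑) =
      d₁ A.∨ d₂ , e-∨-least d₁≤O d₂≤O ,
      λ d' d₁∨d₂≤d' d'≤O → P↑ d' (A.trans (A.x≤x∨y d₁ d₂) d₁∨d₂≤d') d'≤O ,
                           Q↑ d' (A.trans (A.y≤x∨y d₁ d₂) d₁∨d₂≤d') d'≤O

    eventually-∀Fin : ∀ n {P : Fin n → A.Carrier → Set} →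
                      (∀ j → Eventually O (P j)) → Eventually O (λ d → ∀ j → P j d)
    eventually-∀Fin zero    _  = eventually-always λ _ ()
    eventually-∀Fin (suc n) ev =
      eventually-map (λ { _ (P₀ , Pₛ) zero → P₀ ; _ (P₀ , Pₛ) (suc j) → Pₛ j })
                     (eventually-× (ev zero) (eventually-∀Fin n (λ j → ev (suc j))))

    eventually-All : ∀ {B : Set} {P : B → A.Carrier → Set} {xs : List B} →
                     All (λ x → Eventually O (P x)) xs → Eventually O (λ d → All (λ x → P x d) xs)
    eventually-All []         = eventually-always λ _ → []
    eventually-All (ev ∷ evs) =
      eventually-map (λ _ (P , Ps) → P ∷ Ps) (eventually-× ev (eventually-All evs))

module SlantedProperties {Sig : Signature} {A : BL} (X : CanExt A) (𝔸 : Slanted Sig A X) where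
  open CanExtProperties X public
  open Signature Sig public
  open Slanted 𝔸 public
  open Ext X 𝔸 public

  MonotoneAt : ∀ {n} → ((Fin n → A.Carrier) → Carrier) → Pol → Fin n → Set
  MonotoneAt h π i =
    ∀ a b → (∀ j → j ≢ i → a j A.≈ b j) → polLe A._≤_ π (a i) (b i) → h a ≤ h b

  monotoneAt⇒monotone : ∀ {n} (ε : Fin n → Pol) (h : (Fin n → A.Carrier) → Carrier) →
    Cong X h → (∀ i → MonotoneAt h (ε i) i) → ∀ a b → Leε A._≤_ ε a b → h a ≤ h b
  monotoneAt⇒monotone {zero} ε h h-cong _ a b _ = ≈⇒≤ (h-cong a b λ ())
  monotoneAt⇒monotone {suc n} ε h h-cong h-mono a b a≤b =
    ≤-trans (h-mono zero a (b zero ∷ᵛ tail a) agree-off-zero (a≤b zero))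
      (≤-trans (monotoneAt⇒monotone (tail ε) (λ r → h (b zero ∷ᵛ r)) tail-cong tail-mono
                                    (tail a) (tail b) (λ j → a≤b (suc j)))
               (≈⇒≤ (h-cong _ _ λ { zero → A.Eq.refl ; (suc j) → A.Eq.refl })))
    where
    agree-off-zero : ∀ j → j ≢ zero → a j A.≈ (b zero ∷ᵛ tail a) j
    agree-off-zero zero    0≢0 = ⊥-elim (0≢0 refl)
    agree-off-zero (suc j) _   = A.Eq.refl
    tail-cong : Cong X (λ r → h (b zero ∷ᵛ r))
    tail-cong r s r≈s = h-cong _ _ λ { zero → A.Eq.refl ; (suc j) → r≈s j }
    tail-mono : ∀ i → MonotoneAt (λ r → h (b zero ∷ᵛ r)) (ε (suc i)) i
    tail-mono i r s agree r≤s = h-mono (suc i) _ _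
      (λ { zero _ → A.Eq.refl ; (suc j) sj≢si → agree j (λ j≡i → sj≢si (cong suc j≡i)) }) r≤s

  module _ {n} {h : (Fin n → A.Carrier) → Carrier} (h-cong : Cong X h) (i : Fin n) where

    upd-monotone⇒monotoneAt : ∀ π →
      (∀ a x y → polLe A._≤_ π x y → h (upd a i x) ≤ h (upd a i y)) → MonotoneAt h π i
    upd-monotone⇒monotoneAt π mono a b agree a≤b =
      ≤-trans (≈⇒≤ (h-cong _ _ λ j → A.Eq.reflexive (sym (upd-self a i j))))
        (≤-trans (mono a (a i) (b i) a≤b)
                 (≈⇒≤ (h-cong _ _ (upd-pointwise a i (b i) (λ j z → z A.≈ b j) A.Eq.refl agree))))

    h-upd-cong : ∀ a {x y} → x A.≈ y → h (upd a i x) ≈ h (upd a i y)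
    h-upd-cong a {x} {y} x≈y = h-cong _ _ upd-cong
      where
      upd-cong : ∀ j → upd a i x j A.≈ upd a i y j
      upd-cong j with j ≟ i
      ... | yes _ = x≈y
      ... | no _  = A.Eq.refl

    presJoinAt⇒monotoneAt : ∀ π → PresJoinAt X h π i → MonotoneAt h π i
    presJoinAt⇒monotoneAt one (pres-∨ , _) = upd-monotone⇒monotoneAt one λ a x y x≤y →
      ≤-trans x≤x∨y (≤-trans (≈⇒≥ (pres-∨ a x y))
        (≈⇒≤ (h-upd-cong a (A.antisym (A.∨-least x≤y A.refl) (A.y≤x∨y x y)))))
    presJoinAt⇒monotoneAt ∂ (pres-∧ , _) = upd-monotone⇒monotoneAt ∂ λ a x y y≤x →
      ≤-trans x≤x∨y (≤-trans (≈⇒≥ (pres-∧ a x y))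
        (≈⇒≤ (h-upd-cong a (A.antisym (A.x∧y≤y x y) (A.∧-greatest y≤x A.refl)))))

    presMeetAt⇒monotoneAt : ∀ π → PresMeetAt X h π i → MonotoneAt h π i
    presMeetAt⇒monotoneAt one (pres-∧ , _) = upd-monotone⇒monotoneAt one λ a x y x≤y →
      ≤-trans (≈⇒≤ (h-upd-cong a (A.antisym (A.∧-greatest A.refl x≤y) (A.x∧y≤x x y))))
        (≤-trans (≈⇒≤ (pres-∧ a x y)) x∧y≤y)
    presMeetAt⇒monotoneAt ∂ (pres-∨ , _) = upd-monotone⇒monotoneAt ∂ λ a x y y≤x →
      ≤-trans (≈⇒≤ (h-upd-cong a (A.antisym (A.x≤x∨y x y) (A.∨-least A.refl y≤x))))
        (≤-trans (≈⇒≤ (pres-∨ a x y)) x∧y≤y)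

  fA-mono : ∀ f a b → Leε A._≤_ (εF f) a b → fA f a ≤ fA f b
  fA-mono f = monotoneAt⇒monotone (εF f) (fA f) (fA-cong f)
    λ i → presJoinAt⇒monotoneAt (fA-cong f) i (εF f i) (fA-join f i)

  gA-mono : ∀ g a b → Leε A._≤_ (εG g) a b → gA g a ≤ gA g b
  gA-mono g = monotoneAt⇒monotone (εG g) (gA g) (gA-cong g)
    λ i → presMeetAt⇒monotoneAt (gA-cong g) i (εG g i) (gA-meet g i)

  polTop polBot : Pol → A.Carrier
  polTop one = A.⊤
  polTop ∂   = A.⊥
  polBot one = A.⊥
  polBot ∂   = A.⊤

  polMeet polJoin : Pol → A.Carrier → A.Carrier → A.Carrier
  polMeet one = A._∧_
  polMeet ∂   = A._∨_
  polJoin one = A._∨_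
  polJoin ∂   = A._∧_

  ≤-e-polTop : ∀ π {u} → polLe _≤_ π u (e (polTop π))
  ≤-e-polTop one = ≤-e⊤
  ≤-e-polTop ∂   = e⊥-≤

  e-polBot-≤ : ∀ π {u} → polLe _≤_ π (e (polBot π)) u
  e-polBot-≤ one = e⊥-≤
  e-polBot-≤ ∂   = ≤-e⊤

  ≤-e-polMeet : ∀ π {u x y} → polLe _≤_ π u (e x) → polLe _≤_ π u (e y) →
                polLe _≤_ π u (e (polMeet π x y))
  ≤-e-polMeet one = e-∧-greatest
  ≤-e-polMeet ∂   = e-∨-least

  e-polJoin-≤ : ∀ π {u x y} → polLe _≤_ π (e x) u → polLe _≤_ π (e y) u →
                polLe _≤_ π (e (polJoin π x y)) u
  e-polJoin-≤ one = e-∨-least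
  e-polJoin-≤ ∂   = e-∧-greatest

  polMeet-≤ˡ : ∀ π x y → polLe A._≤_ π (polMeet π x y) x
  polMeet-≤ˡ one = A.x∧y≤x
  polMeet-≤ˡ ∂   = A.x≤x∨y

  polMeet-≤ʳ : ∀ π x y → polLe A._≤_ π (polMeet π x y) y
  polMeet-≤ʳ one = A.x∧y≤y
  polMeet-≤ʳ ∂   = A.y≤x∨y

  ≤-polJoinˡ : ∀ π x y → polLe A._≤_ π x (polJoin π x y)
  ≤-polJoinˡ one = A.x≤x∨y
  ≤-polJoinˡ ∂   = A.x∧y≤x

  ≤-polJoinʳ : ∀ π x y → polLe A._≤_ π y (polJoin π x y)
  ≤-polJoinʳ one = A.y≤x∨y
  ≤-polJoinʳ ∂   = A.x∧y≤y

  fσ-mono : ∀ f {u u'} → Leε _≤_ (εF f) u u' → fσ f u ≤ fσ f u'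
  fσ-mono f u≤u' = ⋁-mono λ { _ (k , k-closed , k≤u , x≈) →
    k , k-closed , Leε-trans (εF f) k≤u u≤u' , x≈ }

  fσ-≤-fA : ∀ f {u} a → Leε _≤_ (εF f) u (λ j → e (a j)) → fσ f u ≤ fA f a
  fσ-≤-fA f a u≤a = ⋁-lub _ _ λ { _ (k , _ , k≤u , x≈) →
    ≤-trans (≈⇒≤ x≈) (⋀-lb _ (fA f a) (a , Leε-trans (εF f) k≤u u≤a , Eq.refl)) }

  fσK-≤-fσ : ∀ f {k} → ClosedTuple (εF f) k → fσK f k ≤ fσ f k
  fσK-≤-fσ f k-closed = ⋁-ub _ _ (_ , k-closed , Leε-refl (εF f) , Eq.refl)

  gπ-mono : ∀ g {u u'} → Leε _≤_ (εG g) u u' → gπ g u ≤ gπ g u'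
  gπ-mono g u≤u' = ⋀-antitone λ { _ (o , o-open , u'≤o , x≈) →
    o , o-open , Leε-trans (εG g) u≤u' u'≤o , x≈ }

  gA-≤-gπ : ∀ g {u} a → Leε _≤_ (εG g) (λ j → e (a j)) u → gA g a ≤ gπ g u
  gA-≤-gπ g a a≤u = ⋀-glb _ _ λ { _ (o , _ , u≤o , x≈) →
    ≤-trans (⋁-ub _ (gA g a) (a , Leε-trans (εG g) a≤u u≤o , Eq.refl)) (≈⇒≥ x≈) }

  gπ-≤-gπO : ∀ g {o} → OpenTuple (εG g) o → gπ g o ≤ gπO g o
  gπ-≤-gπO g o-open = ⋀-lb _ _ (_ , o-open , Leε-refl (εG g) , Eq.refl)

  BoundsFAbove : ∀ f → (Fin (arF f) → Carrier) → A.Carrier → Set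
  BoundsFAbove f u b =
    Σ (Fin (arF f) → A.Carrier) λ a → Leε _≤_ (εF f) u (λ j → e (a j)) × fA f a ≤ e b

  BoundsGBelow : ∀ g → (Fin (arG g) → Carrier) → A.Carrier → Set
  BoundsGBelow g u b =
    Σ (Fin (arG g) → A.Carrier) λ a → Leε _≤_ (εG g) (λ j → e (a j)) u × e b ≤ gA g a

  boundsFAbove-downDirected : ∀ f u → DownDirected (BoundsFAbove f u)
  boundsFAbove-downDirected f u =
    (A.⊤ , (λ j → polTop (εF f j)) , (λ j → ≤-e-polTop (εF f j)) , ≤-e⊤) ,
    λ { b₁ b₂ (a₁ , u≤a₁ , fa₁≤b₁) (a₂ , u≤a₂ , fa₂≤b₂) →
          b₁ A.∧ b₂ ,
          ((λ j → polMeet (εF f j) (a₁ j) (a₂ j)) ,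
           (λ j → ≤-e-polMeet (εF f j) (u≤a₁ j) (u≤a₂ j)) ,
           e-∧-greatest
             (≤-trans (fA-mono f _ _ λ j → polMeet-≤ˡ (εF f j) (a₁ j) (a₂ j)) fa₁≤b₁)
             (≤-trans (fA-mono f _ _ λ j → polMeet-≤ʳ (εF f j) (a₁ j) (a₂ j)) fa₂≤b₂)) ,
          A.refl }

  boundsGBelow-upDirected : ∀ g u → UpDirected (BoundsGBelow g u)
  boundsGBelow-upDirected g u =
    (A.⊥ , (λ j → polBot (εG g j)) , (λ j → e-polBot-≤ (εG g j)) , e⊥-≤) ,
    λ { b₁ b₂ (a₁ , a₁≤u , b₁≤ga₁) (a₂ , a₂≤u , b₂≤ga₂) →
          b₁ A.∨ b₂ ,
          ((λ j → polJoin (εG g j) (a₁ j) (a₂ j)) ,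
           (λ j → e-polJoin-≤ (εG g j) (a₁≤u j) (a₂≤u j)) ,
           e-∨-least
             (≤-trans b₁≤ga₁ (gA-mono g _ _ λ j → ≤-polJoinˡ (εG g j) (a₁ j) (a₂ j)))
             (≤-trans b₂≤ga₂ (gA-mono g _ _ λ j → ≤-polJoinʳ (εG g j) (a₁ j) (a₂ j)))) ,
          A.refl }

  ⋀boundsFAbove-≤-fσK : ∀ f u → ⋀ (img (BoundsFAbove f u)) ≤ fσK f u
  ⋀boundsFAbove-≤-fσK f u = ⋀-glb _ _ λ { _ (a , u≤a , x≈fa) →
    ≤-trans (⋀img-glb (λ b fa≤b → ⋀img-lb (a , u≤a , fa≤b)))
            (≤-trans (≈⇒≥ (fA-closed f a)) (≈⇒≥ x≈fa)) }

  gπO-≤-⋁boundsGBelow : ∀ g u → gπO g u ≤ ⋁ (img (BoundsGBelow g u))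
  gπO-≤-⋁boundsGBelow g u = ⋁-lub _ _ λ { _ (a , a≤u , x≈ga) →
    ≤-trans (≈⇒≤ x≈ga)
            (≤-trans (≈⇒≤ (gA-open g a)) (⋁img-lub (λ b b≤ga → ⋁img-ub (a , a≤u , b≤ga)))) }

  fσ≤open⇒fA≤open : ∀ f {u o} → ClosedTuple (εF f) u → Open o → fσ f u ≤ o →
    Σ (Fin (arF f) → A.Carrier) λ a → Leε _≤_ (εF f) u (λ j → e (a j)) × fA f a ≤ o
  fσ≤open⇒fA≤open f {u} u-closed o-open fσu≤o
    with interpolate (⋀img-closed _) o-open
                     (≤-trans (⋀boundsFAbove-≤-fσK f u) (≤-trans (fσK-≤-fσ f u-closed) fσu≤o))
  ... | c , ⋀≤c , c≤o with compact-downDirected (boundsFAbove-downDirected f u) c ⋀≤c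
  ... | b , (a , u≤a , fa≤b) , b≤c = a , u≤a , ≤-trans fa≤b (≤-trans (e-mono b≤c) c≤o)

  closed≤gπ⇒closed≤gA : ∀ g {u k} → OpenTuple (εG g) u → Closed k → k ≤ gπ g u →
    Σ (Fin (arG g) → A.Carrier) λ a → Leε _≤_ (εG g) (λ j → e (a j)) u × k ≤ gA g a
  closed≤gπ⇒closed≤gA g {u} u-open k-closed k≤gπu
    with interpolate k-closed (⋁img-open _)
                     (≤-trans k≤gπu (≤-trans (gπ-≤-gπO g u-open) (gπO-≤-⋁boundsGBelow g u)))
  ... | c , k≤c , c≤⋁ with compact-upDirected (boundsGBelow-upDirected g u) c c≤⋁
  ... | b , (a , a≤u , b≤ga) , c≤b = a , a≤u , ≤-trans k≤c (≤-trans (e-mono c≤b) b≤ga)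

  fσ-closed : ∀ f {u} → ClosedTuple (εF f) u → Closed (fσ f u)
  fσ-closed f u-closed = interpolants⇒closed λ o o-open fσu≤o →
    let (a , u≤a , fa≤o) = fσ≤open⇒fA≤open f u-closed o-open fσu≤o
        (c , fa≤c , c≤o) = interpolate (fA-closed f a) o-open fa≤o
    in c , ≤-trans (fσ-≤-fA f a u≤a) fa≤c , c≤o

  gπ-open : ∀ g {u} → OpenTuple (εG g) u → Open (gπ g u)
  gπ-open g u-open = interpolants⇒open λ k k-closed k≤gπu →
    let (a , a≤u , k≤ga) = closed≤gπ⇒closed≤gA g u-open k-closed k≤gπu
        (c , k≤c , c≤ga) = interpolate k-closed (gA-open g a) k≤ga
    in c , k≤c , ≤-trans c≤ga (gA-≤-gπ g a a≤u)

override : ∀ {X : Set} → (ℕ → X) → ℕ → X → ℕ → X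
override ρ p x q with q ℕ.≟ p
... | yes _ = x
... | no _  = ρ q

module _ {X : Set} (ρ : ℕ → X) (p : ℕ) (x : X) where

  override-at : override ρ p x p ≡ x
  override-at with p ℕ.≟ p
  ... | yes _   = refl
  ... | no p≢p = ⊥-elim (p≢p refl)

  override-other : ∀ {q} → q ≢ p → override ρ p x q ≡ ρ q
  override-other {q} q≢p with q ℕ.≟ p
  ... | yes q≡p = ⊥-elim (q≢p q≡p)
  ... | no _    = refl

isF≢isG : isF ≢ isG
isF≢isG ()

override-∘ : ∀ {X Y : Set} (f : X → Y) (ρ : ℕ → X) p x q →
             f (override ρ p x q) ≡ override (λ r → f (ρ r)) p (f x) q
override-∘ f ρ p x q with q ℕ.≟ p
... | yes _ = refl
... | no _  = refl

override-agree : ∀ {X : Set} {σ ρ : ℕ → X} p → (∀ q → q ≢ p → σ q ≡ ρ q) →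
                 ∀ q → σ q ≡ override ρ p (σ p) q
override-agree p σ≡ρ q with q ℕ.≟ p
... | yes refl = refl
... | no q≢p   = σ≡ρ q q≢p

polarity : ∀ π → π ≡ one ⊎ π ≡ ∂
polarity one = inj₁ refl
polarity ∂   = inj₂ refl

module SyntaxProperties (Sig : Signature) where
  open Syntax Sig

  kindAt-first : ∀ {π k₁ k₂} → k₁ ≢ k₂ → kindAt π k₁ k₂ ≡ k₁ → π ≡ one
  kindAt-first {one} _     _     = refl
  kindAt-first {∂}   k₁≢k₂ k₂≡k₁ = ⊥-elim (k₁≢k₂ (sym k₂≡k₁))

  kindAt-second : ∀ {π k₁ k₂} → k₁ ≢ k₂ → kindAt π k₁ k₂ ≡ k₂ → π ≡ ∂
  kindAt-second {one} k₁≢k₂ k₁≡k₂ = ⊥-elim (k₁≢k₂ k₁≡k₂)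
  kindAt-second {∂}   _     _     = refl

  module _ {n} (i : Fin n) (ε : Fin n → Pol) where

    εres-at : ε i ≡ one → εres i ε i ≡ one
    εres-at εi≡one with ε i | i ≟ i | εi≡one
    ... | one | yes _   | _ = refl
    ... | one | no i≢i | _ = ⊥-elim (i≢i refl)
    ... | ∂   | _       | ()

    εres-other : ε i ≡ one → ∀ {j} → j ≢ i → εres i ε j ≡ flip (ε j)
    εres-other εi≡one {j} j≢i with ε i | j ≟ i | εi≡one
    ... | one | yes j≡i | _ = ⊥-elim (j≢i j≡i)
    ... | one | no _    | _ = refl
    ... | ∂   | _       | ()

    εres-∂ : ε i ≡ ∂ → ∀ j → εres i ε j ≡ ε j
    εres-∂ εi≡∂ j with ε i | εi≡∂
    ... | ∂   | _  = refl
    ... | one | ()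

module Evaluation {Sig : Signature} {A : BL} (X : CanExt A) (𝔸 : Slanted Sig A X) where
  open SlantedProperties X 𝔸 public
  open Syntax Sig public
  open SyntaxProperties Sig public
  open Sem X 𝔸 public
  open PartialOrderReasoning poset

  module _ {S : Carrier → Set} {π : Pol} where

    ⋁⋀-one : π ≡ one → ⋁⋀ π S ≡ ⋁ S
    ⋁⋀-one refl = refl

    ⋁⋀-∂ : π ≡ ∂ → ⋁⋀ π S ≡ ⋀ S
    ⋁⋀-∂ refl = refl

    ⋀⋁-one : π ≡ one → ⋀⋁ π S ≡ ⋀ S
    ⋀⋁-one refl = refl

    ⋀⋁-∂ : π ≡ ∂ → ⋀⋁ π S ≡ ⋁ S
    ⋀⋁-∂ refl = refl

  module _ {n} (ε : Fin n → Pol) (i : Fin n) {u u' : Fin n → Carrier}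
           (u≤u' : Leε _≤_ (εres i ε) u u') where

    εres-one-at : ε i ≡ one → u i ≤ u' i
    εres-one-at εi≡one = subst (λ π → polLe _≤_ π (u i) (u' i)) (εres-at i ε εi≡one) (u≤u' i)

    εres-one-other : ε i ≡ one → ∀ j → j ≢ i → polLe _≤_ (ε j) (u' j) (u j)
    εres-one-other εi≡one j j≢i = polLe-flip (ε j)
      (subst (λ π → polLe _≤_ π (u j) (u' j)) (εres-other i ε εi≡one j≢i) (u≤u' j))

    εres-∂-all : ε i ≡ ∂ → Leε _≤_ ε u u'
    εres-∂-all εi≡∂ j =
      subst (λ π → polLe _≤_ π (u j) (u' j)) (εres-∂ i ε εi≡∂ j) (u≤u' j)

    εres-∂-at : ε i ≡ ∂ → u' i ≤ u i
    εres-∂-at εi≡∂ = subst (λ π → polLe _≤_ π (u i) (u' i)) εi≡∂ (εres-∂-all εi≡∂ i)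

  f♯-mono : ∀ f i {u u'} → Leε _≤_ (εres i (εF f)) u u' → f♯ f i u ≤ f♯ f i u'
  f♯-mono f i {u} {u'} u≤u' with polarity (εF f i)
  ... | inj₁ εi≡one = begin
    f♯ f i u                            ≡⟨ ⋁⋀-one εi≡one ⟩
    ⋁ (λ y → fσ f (upd u i y) ≤ u i)    ≤⟨ ⋁-mono residuals-grow ⟩
    ⋁ (λ y → fσ f (upd u' i y) ≤ u' i)  ≡⟨ sym (⋁⋀-one εi≡one) ⟩
    f♯ f i u'                           ∎
    where
    residuals-grow : ∀ y → fσ f (upd u i y) ≤ u i → fσ f (upd u' i y) ≤ u' i
    residuals-grow y fσ≤ui = begin
      fσ f (upd u' i y)  ≤⟨ fσ-mono f (upd-mono (εF f) i (polLe-≤-refl (εF f i))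
                                                (εres-one-other (εF f) i u≤u' εi≡one)) ⟩
      fσ f (upd u i y)   ≤⟨ fσ≤ui ⟩
      u i                ≤⟨ εres-one-at (εF f) i u≤u' εi≡one ⟩
      u' i               ∎
  ... | inj₂ εi≡∂ = begin
    f♯ f i u                            ≡⟨ ⋁⋀-∂ εi≡∂ ⟩
    ⋀ (λ y → fσ f (upd u i y) ≤ u i)    ≤⟨ ⋀-antitone residuals-shrink ⟩
    ⋀ (λ y → fσ f (upd u' i y) ≤ u' i)  ≡⟨ sym (⋁⋀-∂ εi≡∂) ⟩
    f♯ f i u'                           ∎
    where
    residuals-shrink : ∀ y → fσ f (upd u' i y) ≤ u' i → fσ f (upd u i y) ≤ u i
    residuals-shrink y fσ≤u'i = begin
      fσ f (upd u i y)   ≤⟨ fσ-mono f (upd-mono (εF f) i (polLe-≤-refl (εF f i))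
                                                λ j _ → εres-∂-all (εF f) i u≤u' εi≡∂ j) ⟩
      fσ f (upd u' i y)  ≤⟨ fσ≤u'i ⟩
      u' i               ≤⟨ εres-∂-at (εF f) i u≤u' εi≡∂ ⟩
      u i                ∎

  g♭-mono : ∀ g i {u u'} → Leε _≤_ (εres i (εG g)) u u' → g♭ g i u ≤ g♭ g i u'
  g♭-mono g i {u} {u'} u≤u' with polarity (εG g i)
  ... | inj₁ εi≡one = begin
    g♭ g i u                            ≡⟨ ⋀⋁-one εi≡one ⟩
    ⋀ (λ y → u i ≤ gπ g (upd u i y))    ≤⟨ ⋀-antitone residuals-shrink ⟩
    ⋀ (λ y → u' i ≤ gπ g (upd u' i y))  ≡⟨ sym (⋀⋁-one εi≡one) ⟩
    g♭ g i u'                           ∎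
    where
    residuals-shrink : ∀ y → u' i ≤ gπ g (upd u' i y) → u i ≤ gπ g (upd u i y)
    residuals-shrink y u'i≤gπ = begin
      u i                ≤⟨ εres-one-at (εG g) i u≤u' εi≡one ⟩
      u' i               ≤⟨ u'i≤gπ ⟩
      gπ g (upd u' i y)  ≤⟨ gπ-mono g (upd-mono (εG g) i (polLe-≤-refl (εG g i))
                                                (εres-one-other (εG g) i u≤u' εi≡one)) ⟩
      gπ g (upd u i y)   ∎
  ... | inj₂ εi≡∂ = begin
    g♭ g i u                            ≡⟨ ⋀⋁-∂ εi≡∂ ⟩
    ⋁ (λ y → u i ≤ gπ g (upd u i y))    ≤⟨ ⋁-mono residuals-grow ⟩
    ⋁ (λ y → u' i ≤ gπ g (upd u' i y))  ≡⟨ sym (⋀⋁-∂ εi≡∂) ⟩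
    g♭ g i u'                           ∎
    where
    residuals-grow : ∀ y → u i ≤ gπ g (upd u i y) → u' i ≤ gπ g (upd u' i y)
    residuals-grow y ui≤gπ = begin
      u' i               ≤⟨ εres-∂-at (εG g) i u≤u' εi≡∂ ⟩
      u i                ≤⟨ ui≤gπ ⟩
      gπ g (upd u i y)   ≤⟨ gπ-mono g (upd-mono (εG g) i (polLe-≤-refl (εG g i))
                                                λ j _ → εres-∂-all (εG g) i u≤u' εi≡∂ j) ⟩
      gπ g (upd u' i y)  ∎

  interp-mono : ∀ h {u u'} → Leε _≤_ (εC h) u u' → interp h u ≤ interp h u'
  interp-mono (fc f)    = fσ-mono f
  interp-mono (gc g)    = gπ-mono g
  interp-mono (fsh f i) = f♯-mono f i
  interp-mono (gfl g i) = g♭-mono g i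

  interp-cong : ∀ h {u u'} → (∀ j → u j ≈ u' j) → interp h u ≈ interp h u'
  interp-cong h u≈u' = ≤-antisym (interp-mono h λ j → ≈⇒polLe (εC h j) (u≈u' j))
                                 (interp-mono h λ j → ≈⇒polLe (εC h j) (Eq.sym (u≈u' j)))

  -- Variables take values in A^δ, so that p can be sent to the open value of α.
  eval : (ℕ → Carrier) → (ℕ → Carrier) → (ℕ → Carrier) → Term → Carrier
  eval P N M (var q)    = P q
  eval P N M (nom j)    = N j
  eval P N M (conom m)  = M m
  eval P N M ⊤t         = ⊤c
  eval P N M ⊥t         = ⊥c
  eval P N M (φ ∧t ψ)   = eval P N M φ ∧c eval P N M ψ
  eval P N M (φ ∨t ψ)   = eval P N M φ ∨c eval P N M ψ
  eval P N M (app h ts) = interp h (λ j → eval P N M (ts j))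

  ⟦⟧≈eval : ∀ t v → ⟦ t ⟧ v ≈ eval (λ q → e (valP v q)) (valN v) (valM v) t
  ⟦⟧≈eval (var q)    v = Eq.refl
  ⟦⟧≈eval (nom j)    v = Eq.refl
  ⟦⟧≈eval (conom m)  v = Eq.refl
  ⟦⟧≈eval ⊤t         v = Eq.refl
  ⟦⟧≈eval ⊥t         v = Eq.refl
  ⟦⟧≈eval (φ ∧t ψ)   v = ∧-cong (⟦⟧≈eval φ v) (⟦⟧≈eval ψ v)
  ⟦⟧≈eval (φ ∨t ψ)   v = ∨-cong (⟦⟧≈eval φ v) (⟦⟧≈eval ψ v)
  ⟦⟧≈eval (app h ts) v = interp-cong h λ j → ⟦⟧≈eval (ts j) v

  module _ {P P' N N' M M' : ℕ → Carrier} (N≈N' : ∀ j → N j ≈ N' j) (M≈M' : ∀ m → M m ≈ M' m) where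

    eval-cong : (∀ q → P q ≈ P' q) → ∀ t → eval P N M t ≈ eval P' N' M' t
    eval-cong P≈P' (var q)    = P≈P' q
    eval-cong P≈P' (nom j)    = N≈N' j
    eval-cong P≈P' (conom m)  = M≈M' m
    eval-cong P≈P' ⊤t         = Eq.refl
    eval-cong P≈P' ⊥t         = Eq.refl
    eval-cong P≈P' (φ ∧t ψ)   = ∧-cong (eval-cong P≈P' φ) (eval-cong P≈P' ψ)
    eval-cong P≈P' (φ ∨t ψ)   = ∨-cong (eval-cong P≈P' φ) (eval-cong P≈P' ψ)
    eval-cong P≈P' (app h ts) = interp-cong h λ j → eval-cong P≈P' (ts j)

    eval-noOcc : ∀ p → (∀ q → q ≢ p → P q ≈ P' q) → ∀ t → NoOcc p t → eval P N M t ≈ eval P' N' M' t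
    eval-noOcc p P≈P' (var q)    q≢p        = P≈P' q q≢p
    eval-noOcc p P≈P' (nom j)    _          = N≈N' j
    eval-noOcc p P≈P' (conom m)  _          = M≈M' m
    eval-noOcc p P≈P' ⊤t         _          = Eq.refl
    eval-noOcc p P≈P' ⊥t         _          = Eq.refl
    eval-noOcc p P≈P' (φ ∧t ψ)   (nφ , nψ) = ∧-cong (eval-noOcc p P≈P' φ nφ) (eval-noOcc p P≈P' ψ nψ)
    eval-noOcc p P≈P' (φ ∨t ψ)   (nφ , nψ) = ∨-cong (eval-noOcc p P≈P' φ nφ) (eval-noOcc p P≈P' ψ nψ)
    eval-noOcc p P≈P' (app h ts) nts        = interp-cong h λ j → eval-noOcc p P≈P' (ts j) (nts j)

  module _ (p : ℕ) where

    noOcc⇒posIn : ∀ t → NoOcc p t → PosIn p t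
    noOcc⇒negIn : ∀ t → NoOcc p t → NegIn p t
    noOcc⇒signAt : ∀ π t → NoOcc p t → SignAt π p t

    noOcc⇒signAt one = noOcc⇒posIn
    noOcc⇒signAt ∂   = noOcc⇒negIn

    noOcc⇒posIn (var q)    _          = tt
    noOcc⇒posIn (nom _)    _          = tt
    noOcc⇒posIn (conom _)  _          = tt
    noOcc⇒posIn ⊤t         _          = tt
    noOcc⇒posIn ⊥t         _          = tt
    noOcc⇒posIn (φ ∧t ψ)   (nφ , nψ) = noOcc⇒posIn φ nφ , noOcc⇒posIn ψ nψ
    noOcc⇒posIn (φ ∨t ψ)   (nφ , nψ) = noOcc⇒posIn φ nφ , noOcc⇒posIn ψ nψ
    noOcc⇒posIn (app h ts) nts        = λ j → noOcc⇒signAt (εC h j) (ts j) (nts j)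

    noOcc⇒negIn (var q)    q≢p        = q≢p
    noOcc⇒negIn (nom _)    _          = tt
    noOcc⇒negIn (conom _)  _          = tt
    noOcc⇒negIn ⊤t         _          = tt
    noOcc⇒negIn ⊥t         _          = tt
    noOcc⇒negIn (φ ∧t ψ)   (nφ , nψ) = noOcc⇒negIn φ nφ , noOcc⇒negIn ψ nψ
    noOcc⇒negIn (φ ∨t ψ)   (nφ , nψ) = noOcc⇒negIn φ nφ , noOcc⇒negIn ψ nψ
    noOcc⇒negIn (app h ts) nts        = λ j → noOcc⇒signAt (flip (εC h j)) (ts j) (nts j)

    module _ {N M P P' : ℕ → Carrier} (P≈P' : ∀ q → q ≢ p → P q ≈ P' q) (Pp≤P'p : P p ≤ P' p) where

      eval-posIn-mono : ∀ t → PosIn p t → eval P N M t ≤ eval P' N M t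
      eval-negIn-anti : ∀ t → NegIn p t → eval P' N M t ≤ eval P N M t
      eval-signAt : ∀ π t → SignAt π p t → polLe _≤_ π (eval P N M t) (eval P' N M t)

      eval-signAt one = eval-posIn-mono
      eval-signAt ∂   = eval-negIn-anti

      eval-posIn-mono (var q) _ with q ℕ.≟ p
      ... | yes refl = Pp≤P'p
      ... | no q≢p   = ≈⇒≤ (P≈P' q q≢p)
      eval-posIn-mono (nom _)    _          = ≤-refl
      eval-posIn-mono (conom _)  _          = ≤-refl
      eval-posIn-mono ⊤t         _          = ≤-refl
      eval-posIn-mono ⊥t         _          = ≤-refl
      eval-posIn-mono (φ ∧t ψ)   (sφ , sψ) = ∧-mono (eval-posIn-mono φ sφ) (eval-posIn-mono ψ sψ)
      eval-posIn-mono (φ ∨t ψ)   (sφ , sψ) = ∨-mono (eval-posIn-mono φ sφ) (eval-posIn-mono ψ sψ)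
      eval-posIn-mono (app h ts) sts        = interp-mono h λ j → eval-signAt (εC h j) (ts j) (sts j)

      eval-negIn-anti (var q)    q≢p        = ≈⇒≥ (P≈P' q q≢p)
      eval-negIn-anti (nom _)    _          = ≤-refl
      eval-negIn-anti (conom _)  _          = ≤-refl
      eval-negIn-anti ⊤t         _          = ≤-refl
      eval-negIn-anti ⊥t         _          = ≤-refl
      eval-negIn-anti (φ ∧t ψ)   (sφ , sψ) = ∧-mono (eval-negIn-anti φ sφ) (eval-negIn-anti ψ sψ)
      eval-negIn-anti (φ ∨t ψ)   (sφ , sψ) = ∨-mono (eval-negIn-anti φ sφ) (eval-negIn-anti ψ sψ)
      eval-negIn-anti (app h ts) sts        =
        interp-mono h λ j → polLe-flip (εC h j) (eval-signAt (flip (εC h j)) (ts j) (sts j))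

    eval-subst : ∀ P N M t α → eval P N M (t [ α / p ]) ≈ eval (override P p (eval P N M α)) N M t
    eval-subst P N M (var q) α with q ℕ.≟ p
    ... | yes _ = Eq.refl
    ... | no _  = Eq.refl
    eval-subst P N M (nom j)    α = Eq.refl
    eval-subst P N M (conom m)  α = Eq.refl
    eval-subst P N M ⊤t         α = Eq.refl
    eval-subst P N M ⊥t         α = Eq.refl
    eval-subst P N M (φ ∧t ψ)   α = ∧-cong (eval-subst P N M φ α) (eval-subst P N M ψ α)
    eval-subst P N M (φ ∨t ψ)   α = ∨-cong (eval-subst P N M φ α) (eval-subst P N M ψ α)
    eval-subst P N M (app h ts) α = interp-cong h λ j → eval-subst P N M (ts j) α

module _ {X : Set} {R : Rel X 0ℓ} {π : Pol} {x y : X} where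

  polLe-one⇒ : π ≡ one → polLe R π x y → R x y
  polLe-one⇒ refl le = le

  ⇒polLe-one : π ≡ one → R x y → polLe R π x y
  ⇒polLe-one refl le = le

  polLe-∂⇒ : π ≡ ∂ → polLe R π x y → R y x
  polLe-∂⇒ refl le = le

  ⇒polLe-∂ : π ≡ ∂ → R y x → polLe R π x y
  ⇒polLe-∂ refl le = le

module Approximation {Sig : Signature} {A : BL} (X : CanExt A) (𝔸 : Slanted Sig A X)
                     (O : CompleteLattice.Carrier (CanExt.C X)) where
  open Evaluation X 𝔸 public

  -- The invariants of the induction on terms, for W a term as a function of the value of p.
  ClosedApprox OpenApprox : (Carrier → Carrier) → Set
  ClosedApprox W = Closed (W O) × (∀ b → W O ≤ e b → Eventually O (λ d → W (e d) ≤ e b))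
  OpenApprox   W = Open (W O)   × (∀ b → e b ≤ W O → Eventually O (λ d → e b ≤ W (e d)))

  ClosedApproxAt OpenApproxAt : Pol → (Carrier → Carrier) → Set
  ClosedApproxAt one = ClosedApprox
  ClosedApproxAt ∂   = OpenApprox
  OpenApproxAt   one = OpenApprox
  OpenApproxAt   ∂   = ClosedApprox

  closedAt-e : ∀ π a → ClosedAt X π (e a)
  closedAt-e one = closed-e
  closedAt-e ∂   = open-e

  openAt-e : ∀ π a → OpenAt X π (e a)
  openAt-e one = open-e
  openAt-e ∂   = closed-e

  closedApproxAt-closedAt : ∀ π {W} → ClosedApproxAt π W → ClosedAt X π (W O)
  closedApproxAt-closedAt one = proj₁
  closedApproxAt-closedAt ∂   = proj₁

  openApproxAt-openAt : ∀ π {W} → OpenApproxAt π W → OpenAt X π (W O)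
  openApproxAt-openAt one = proj₁
  openApproxAt-openAt ∂   = proj₁

  closedApproxAt-eventually : ∀ π {W} c → ClosedApproxAt π W → polLe _≤_ π (W O) (e c) →
                              Eventually O (λ d → polLe _≤_ π (W (e d)) (e c))
  closedApproxAt-eventually one c (_ , approx) = approx c
  closedApproxAt-eventually ∂   c (_ , approx) = approx c

  openApproxAt-eventually : ∀ π {W} c → OpenApproxAt π W → polLe _≤_ π (e c) (W O) →
                            Eventually O (λ d → polLe _≤_ π (e c) (W (e d)))
  openApproxAt-eventually one c (_ , approx) = approx c
  openApproxAt-eventually ∂   c (_ , approx) = approx c

  closedApproxAt-flip : ∀ π {W} → ClosedApproxAt (flip π) W → OpenApproxAt π W
  closedApproxAt-flip one approx = approx
  closedApproxAt-flip ∂   approx = approx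

  openApproxAt-flip : ∀ π {W} → OpenApproxAt (flip π) W → ClosedApproxAt π W
  openApproxAt-flip one approx = approx
  openApproxAt-flip ∂   approx = approx

  closedApproxAt-cast : ∀ {π π' W} → π ≡ π' → ClosedApproxAt π W → ClosedApproxAt π' W
  closedApproxAt-cast refl approx = approx

  openApproxAt-cast : ∀ {π π' W} → π ≡ π' → OpenApproxAt π W → OpenApproxAt π' W
  openApproxAt-cast refl approx = approx

  closedApprox-≡ : ∀ {W W'} → (∀ x → W x ≡ W' x) → ClosedApprox W → ClosedApprox W'
  closedApprox-≡ W≡W' (W-closed , approx) =
    subst Closed (W≡W' O) W-closed ,
    λ b W'O≤b → eventually-map (λ d → subst (_≤ e b) (W≡W' (e d)))
                               (approx b (subst (_≤ e b) (sym (W≡W' O)) W'O≤b))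

  openApprox-≡ : ∀ {W W'} → (∀ x → W x ≡ W' x) → OpenApprox W → OpenApprox W'
  openApprox-≡ W≡W' (W-open , approx) =
    subst Open (W≡W' O) W-open ,
    λ b b≤W'O → eventually-map (λ d → subst (e b ≤_) (W≡W' (e d)))
                               (approx b (subst (e b ≤_) (sym (W≡W' O)) b≤W'O))

  closedApprox-const : ∀ {c} → Closed c → ClosedApprox (λ _ → c)
  closedApprox-const c-closed = c-closed , λ _ c≤b → eventually-always λ _ → c≤b

  openApprox-const : ∀ {c} → Open c → OpenApprox (λ _ → c)
  openApprox-const c-open = c-open , λ _ b≤c → eventually-always λ _ → b≤c

  openApprox-id : Open O → OpenApprox (λ x → x)
  openApprox-id O-open = O-open , λ b b≤O → b , b≤O , λ d b≤d _ → e-mono b≤d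

  module _ {W₁ W₂ : Carrier → Carrier} where

    closedApprox-∧ : ClosedApprox W₁ → ClosedApprox W₂ → ClosedApprox (λ x → W₁ x ∧c W₂ x)
    closedApprox-∧ (W₁-closed , approx₁) (W₂-closed , approx₂) =
      closed-∧ W₁-closed W₂-closed ,
      λ b W≤b →
        let (b₁ , b₂ , W₁≤b₁ , W₂≤b₂ , b₁∧b₂≤b) = closed-∧-split b W₁-closed W₂-closed W≤b
        in eventually-map (λ _ (W₁≤ , W₂≤) → ≤-trans (∧-mono W₁≤ W₂≤) b₁∧b₂≤b)
                          (eventually-× (approx₁ b₁ W₁≤b₁) (approx₂ b₂ W₂≤b₂))

    closedApprox-∨ : ClosedApprox W₁ → ClosedApprox W₂ → ClosedApprox (λ x → W₁ x ∨c W₂ x)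
    closedApprox-∨ (W₁-closed , approx₁) (W₂-closed , approx₂) =
      closed-∨ W₁-closed W₂-closed ,
      λ b W≤b →
        eventually-map (λ _ (W₁≤ , W₂≤) → ∨-least W₁≤ W₂≤)
                       (eventually-× (approx₁ b (≤-trans x≤x∨y W≤b)) (approx₂ b (≤-trans y≤x∨y W≤b)))

    openApprox-∨ : OpenApprox W₁ → OpenApprox W₂ → OpenApprox (λ x → W₁ x ∨c W₂ x)
    openApprox-∨ (W₁-open , approx₁) (W₂-open , approx₂) =
      open-∨ W₁-open W₂-open ,
      λ b b≤W →
        let (b₁ , b₂ , b₁≤W₁ , b₂≤W₂ , b≤b₁∨b₂) = open-∨-split b W₁-open W₂-open b≤W
        in eventually-map (λ _ (≤W₁ , ≤W₂) → ≤-trans b≤b₁∨b₂ (∨-mono ≤W₁ ≤W₂))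
                          (eventually-× (approx₁ b₁ b₁≤W₁) (approx₂ b₂ b₂≤W₂))

    openApprox-∧ : OpenApprox W₁ → OpenApprox W₂ → OpenApprox (λ x → W₁ x ∧c W₂ x)
    openApprox-∧ (W₁-open , approx₁) (W₂-open , approx₂) =
      open-∧ W₁-open W₂-open ,
      λ b b≤W →
        eventually-map (λ _ (≤W₁ , ≤W₂) → ∧-greatest ≤W₁ ≤W₂)
                       (eventually-× (approx₁ b (≤-trans b≤W x∧y≤x)) (approx₂ b (≤-trans b≤W x∧y≤y)))

  closedApprox-fσ : ∀ f (V : Fin (arF f) → Carrier → Carrier) →
    (∀ j → ClosedApproxAt (εF f j) (V j)) → ClosedApprox (λ x → fσ f (λ j → V j x))
  closedApprox-fσ f V V-approx = fσ-closed f V-closed , λ b fσ≤b →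
    let (a , V≤a , fa≤b) = fσ≤open⇒fA≤open f V-closed (open-e b) fσ≤b
    in eventually-map (λ _ V≤a → ≤-trans (fσ-≤-fA f a V≤a) fa≤b)
         (eventually-∀Fin _ λ j → closedApproxAt-eventually (εF f j) (a j) (V-approx j) (V≤a j))
    where
    V-closed : ClosedTuple (εF f) (λ j → V j O)
    V-closed j = closedApproxAt-closedAt (εF f j) (V-approx j)

  openApprox-gπ : ∀ g (V : Fin (arG g) → Carrier → Carrier) →
    (∀ j → OpenApproxAt (εG g j) (V j)) → OpenApprox (λ x → gπ g (λ j → V j x))
  openApprox-gπ g V V-approx = gπ-open g V-open , λ b b≤gπ →
    let (a , a≤V , b≤ga) = closed≤gπ⇒closed≤gA g V-open (closed-e b) b≤gπ
    in eventually-map (λ _ a≤V → ≤-trans b≤ga (gA-≤-gπ g a a≤V))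
         (eventually-∀Fin _ λ j → openApproxAt-eventually (εG g j) (a j) (V-approx j) (a≤V j))
    where
    V-open : OpenTuple (εG g) (λ j → V j O)
    V-open j = openApproxAt-openAt (εG g j) (V-approx j)

  module _ (S : Carrier → Carrier → Set)
           (S-eventually : ∀ a → S O (e a) → Eventually O (λ d → S (e d) (e a))) where

    openApprox-⋁ : (∀ {y k} → S O y → k ≤ y → S O k) →
                   (∀ k → Closed k → S O k → Σ A.Carrier λ a → k ≤ e a × S O (e a)) →
                   OpenApprox (λ x → ⋁ (S x))
    openApprox-⋁ S-down witness =
      open-resp-≈ (⋁img-open T) (≤-antisym (⋁img-lub λ _ Ta → ⋁-ub _ _ Ta) ⋁S≤⋁T) ,
      λ b b≤⋁S →
        let (as , Tas , b≤as) = compact-join T b (≤-trans b≤⋁S ⋁S≤⋁T)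
        in eventually-map (λ _ Sas → ≤-trans b≤as (e-joinList-≤ (λ _ Sa → ⋁-ub _ _ Sa) Sas))
                          (eventually-All (All.map (S-eventually _) Tas))
      where
      T : A.Carrier → Set
      T a = S O (e a)
      ⋁S≤⋁T : ⋁ (S O) ≤ ⋁ (img T)
      ⋁S≤⋁T = ⋁-lub _ _ λ y Sy → ≤-trans (≈⇒≤ (dense-K y)) (⋁-lub _ _ λ { k (k-closed , k≤y) →
        let (a , k≤a , Ta) = witness k k-closed (S-down Sy k≤y) in ≤-trans k≤a (⋁img-ub Ta) })

    closedApprox-⋀ : (∀ {y o} → S O y → y ≤ o → S O o) →
                     (∀ o → Open o → S O o → Σ A.Carrier λ a → e a ≤ o × S O (e a)) →
                     ClosedApprox (λ x → ⋀ (S x))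
    closedApprox-⋀ S-up witness =
      closed-resp-≈ (⋀img-closed T) (≤-antisym ⋀T≤⋀S (⋀img-glb λ _ Ta → ⋀-lb _ _ Ta)) ,
      λ b ⋀S≤b →
        let (as , Tas , as≤b) = compact-meet T b (≤-trans ⋀T≤⋀S ⋀S≤b)
        in eventually-map (λ _ Sas → ≤-trans (≤-e-meetList (λ _ Sa → ⋀-lb _ _ Sa) Sas) as≤b)
                          (eventually-All (All.map (S-eventually _) Tas))
      where
      T : A.Carrier → Set
      T a = S O (e a)
      ⋀T≤⋀S : ⋀ (img T) ≤ ⋀ (S O)
      ⋀T≤⋀S = ⋀-glb _ _ λ y Sy → ≤-trans (⋀-glb _ _ λ { o (o-open , y≤o) →
        let (a , a≤o , Ta) = witness o o-open (S-up Sy y≤o) in ≤-trans (⋀img-lb Ta) a≤o })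
        (≈⇒≥ (dense-O y))

  -- f♯ᵢ is the join (εᵢ = 1) or meet (εᵢ = ∂) of S; by compactness of fσ (witness), every
  -- closed (resp. open) member of S O lies below (resp. above) a member of S O from A.
  module ResidualF (f : FConn) (i : Fin (arF f)) (V : Fin (arF f) → Carrier → Carrier)
                   (V-i : OpenApprox (V i))
                   (V-j : ∀ j → j ≢ i → ClosedApproxAt (εF f j) (V j)) where

    ε : Fin (arF f) → Pol
    ε = εF f

    U : Carrier → Fin (arF f) → Carrier
    U x j = V j x

    S : Carrier → Carrier → Set
    S x y = fσ f (upd (U x) i y) ≤ V i x

    S-anti : ∀ {y y'} → polLe _≤_ (ε i) y' y → S O y → S O y'
    S-anti y'≤y Sy = ≤-trans (fσ-mono f (upd-mono ε i y'≤y λ j _ → polLe-≤-refl (ε j))) Sy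

    upd-closed : ∀ {y} → ClosedAt X (ε i) y → ClosedTuple ε (upd (U O) i y)
    upd-closed y-closed = upd-pointwise (U O) i _ (λ j → ClosedAt X (ε j)) y-closed
                            λ j j≢i → closedApproxAt-closedAt (ε j) (V-j j j≢i)

    witness : ∀ y → ClosedAt X (ε i) y → S O y →
              Σ A.Carrier λ a → polLe _≤_ (ε i) y (e a) × S O (e a)
    witness y y-closed Sy =
      let (a , y≤a , fa≤Vi) = fσ≤open⇒fA≤open f (upd-closed y-closed) (proj₁ V-i) Sy
          ai≤a = upd-≤ε ε (U O) _ i _ (polLe-≤-refl (ε i)) (upd-≤ε-other ε (U O) _ i y y≤a)
      in a i , upd-≤ε-at ε (U O) _ i y y≤a , ≤-trans (fσ-≤-fA f a ai≤a) fa≤Vi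

    S-eventually : ∀ b → S O (e b) → Eventually O (λ d → S (e d) (e b))
    S-eventually b Sb =
      let (a , b≤a , fa≤Vi) = fσ≤open⇒fA≤open f (upd-closed (closedAt-e (ε i) b)) (proj₁ V-i) Sb
          (c , fa≤c , c≤Vi) = interpolate (fA-closed f a) (proj₁ V-i) fa≤Vi
          below : ∀ d → e c ≤ V i (e d) × (∀ j → j ≢ i → polLe _≤_ (ε j) (V j (e d)) (e (a j))) →
                  S (e d) (e b)
          below d (c≤Vi , V≤a) = ≤-trans (fσ-≤-fA f a (upd-≤ε ε (U (e d)) _ i _
                                            (upd-≤ε-at ε (U O) _ i _ b≤a) V≤a))
                                         (≤-trans fa≤c c≤Vi)
      in eventually-map below (eventually-× (proj₂ V-i c c≤Vi) (eventually-∀Fin _ (others a b≤a)))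
      where
      others : ∀ a → Leε _≤_ ε (upd (U O) i (e b)) (λ j → e (a j)) →
               ∀ j → Eventually O (λ d → j ≢ i → polLe _≤_ (ε j) (V j (e d)) (e (a j)))
      others a b≤a j with j ≟ i
      ... | yes j≡i = eventually-always λ _ j≢i → ⊥-elim (j≢i j≡i)
      ... | no j≢i  = eventually-map (λ _ V≤a _ → V≤a)
        (closedApproxAt-eventually (ε j) (a j) (V-j j j≢i) (upd-≤ε-other ε (U O) _ i _ b≤a j j≢i))

    openApprox-one : ε i ≡ one → OpenApprox (λ x → ⋁ (S x))
    openApprox-one εi≡one = openApprox-⋁ S S-eventually
      (λ Sy k≤y → S-anti (⇒polLe-one εi≡one k≤y) Sy)
      λ k k-closed Sk →
        let (a , k≤a , Sa) = witness k (subst (λ π → ClosedAt X π k) (sym εi≡one) k-closed) Sk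
        in a , polLe-one⇒ εi≡one k≤a , Sa

    closedApprox-∂ : ε i ≡ ∂ → ClosedApprox (λ x → ⋀ (S x))
    closedApprox-∂ εi≡∂ = closedApprox-⋀ S S-eventually
      (λ Sy y≤o → S-anti (⇒polLe-∂ εi≡∂ y≤o) Sy)
      λ o o-open So →
        let (a , o≥a , Sa) = witness o (subst (λ π → ClosedAt X π o) (sym εi≡∂) o-open) So
        in a , polLe-∂⇒ εi≡∂ o≥a , Sa

  module ResidualG (g : GConn) (i : Fin (arG g)) (V : Fin (arG g) → Carrier → Carrier)
                   (V-i : ClosedApprox (V i))
                   (V-j : ∀ j → j ≢ i → OpenApproxAt (εG g j) (V j)) where

    ε : Fin (arG g) → Pol
    ε = εG g

    U : Carrier → Fin (arG g) → Carrier
    U x j = V j x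

    S : Carrier → Carrier → Set
    S x y = V i x ≤ gπ g (upd (U x) i y)

    S-mono : ∀ {y y'} → polLe _≤_ (ε i) y y' → S O y → S O y'
    S-mono y≤y' Sy = ≤-trans Sy (gπ-mono g (upd-mono ε i y≤y' λ j _ → polLe-≤-refl (ε j)))

    upd-open : ∀ {y} → OpenAt X (ε i) y → OpenTuple ε (upd (U O) i y)
    upd-open y-open = upd-pointwise (U O) i _ (λ j → OpenAt X (ε j)) y-open
                        λ j j≢i → openApproxAt-openAt (ε j) (V-j j j≢i)

    witness : ∀ y → OpenAt X (ε i) y → S O y →
              Σ A.Carrier λ a → polLe _≤_ (ε i) (e a) y × S O (e a)
    witness y y-open Sy =
      let (a , a≤y , Vi≤ga) = closed≤gπ⇒closed≤gA g (upd-open y-open) (proj₁ V-i) Sy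
          a≤ai = ≤ε-upd ε (U O) _ i _ (polLe-≤-refl (ε i)) (≤ε-upd-other ε (U O) _ i y a≤y)
      in a i , ≤ε-upd-at ε (U O) _ i y a≤y , ≤-trans Vi≤ga (gA-≤-gπ g a a≤ai)

    S-eventually : ∀ b → S O (e b) → Eventually O (λ d → S (e d) (e b))
    S-eventually b Sb =
      let (a , a≤b , Vi≤ga) = closed≤gπ⇒closed≤gA g (upd-open (openAt-e (ε i) b)) (proj₁ V-i) Sb
          (c , Vi≤c , c≤ga) = interpolate (proj₁ V-i) (gA-open g a) Vi≤ga
          above : ∀ d → V i (e d) ≤ e c × (∀ j → j ≢ i → polLe _≤_ (ε j) (e (a j)) (V j (e d))) →
                  S (e d) (e b)
          above d (Vi≤c , a≤V) = ≤-trans Vi≤c (≤-trans c≤ga (gA-≤-gπ g a (≤ε-upd ε (U (e d)) _ i _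
                                   (≤ε-upd-at ε (U O) _ i _ a≤b) a≤V)))
      in eventually-map above (eventually-× (proj₂ V-i c Vi≤c) (eventually-∀Fin _ (others a a≤b)))
      where
      others : ∀ a → Leε _≤_ ε (λ j → e (a j)) (upd (U O) i (e b)) →
               ∀ j → Eventually O (λ d → j ≢ i → polLe _≤_ (ε j) (e (a j)) (V j (e d)))
      others a a≤b j with j ≟ i
      ... | yes j≡i = eventually-always λ _ j≢i → ⊥-elim (j≢i j≡i)
      ... | no j≢i  = eventually-map (λ _ a≤V _ → a≤V)
        (openApproxAt-eventually (ε j) (a j) (V-j j j≢i) (≤ε-upd-other ε (U O) _ i _ a≤b j j≢i))

    closedApprox-one : ε i ≡ one → ClosedApprox (λ x → ⋀ (S x))
    closedApprox-one εi≡one = closedApprox-⋀ S S-eventually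
      (λ Sy y≤o → S-mono (⇒polLe-one εi≡one y≤o) Sy)
      λ o o-open So →
        let (a , a≤o , Sa) = witness o (subst (λ π → OpenAt X π o) (sym εi≡one) o-open) So
        in a , polLe-one⇒ εi≡one a≤o , Sa

    openApprox-∂ : ε i ≡ ∂ → OpenApprox (λ x → ⋁ (S x))
    openApprox-∂ εi≡∂ = openApprox-⋁ S S-eventually
      (λ Sy k≤y → S-mono (⇒polLe-∂ εi≡∂ k≤y) Sy)
      λ k k-closed Sk →
        let (a , k≤a , Sa) = witness k (subst (λ π → OpenAt X π k) (sym εi≡∂) k-closed) Sk
        in a , polLe-∂⇒ εi≡∂ k≤a , Sa

  module TermApproximation (v : Assignment) (p : ℕ) (O-open : Open O) where

    ρ : ℕ → Carrier
    ρ q = e (valP v q)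

    W : Term → Carrier → Carrier
    W t x = eval (override ρ p x) (valN v) (valM v) t

    ssc-closedApprox : ∀ {t} → SSC t → NegIn p t → ClosedApprox (W t)
    sso-openApprox   : ∀ {t} → SSO t → PosIn p t → OpenApprox (W t)
    argC-approx      : ∀ {π t} → ArgC π t → SignAt (flip π) p t → ClosedApproxAt π (W t)
    argO-approx      : ∀ {π t} → ArgO π t → SignAt π p t → OpenApproxAt π (W t)

    argC-approx (one φ) sign = ssc-closedApprox φ sign
    argC-approx (∂ ψ)   sign = sso-openApprox ψ sign
    argO-approx (one ψ) sign = sso-openApprox ψ sign
    argO-approx (∂ φ)   sign = ssc-closedApprox φ sign

    ssc-closedApprox (var q) q≢p =
      closedApprox-≡ (λ x → sym (override-other ρ p x q≢p)) (closedApprox-const (closed-e _))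
    ssc-closedApprox (nom j) _ = closedApprox-const (joinIrr⇒closed (valN-irr v j))
    ssc-closedApprox ⊤t      _ = closedApprox-const closed-⊤
    ssc-closedApprox ⊥t      _ = closedApprox-const closed-⊥
    ssc-closedApprox (_∨t_ {φ} {ψ} sφ sψ) (nφ , nψ) =
      closedApprox-∨ {W φ} {W ψ} (ssc-closedApprox sφ nφ) (ssc-closedApprox sψ nψ)
    ssc-closedApprox (_∧t_ {φ} {ψ} sφ sψ) (nφ , nψ) =
      closedApprox-∧ {W φ} {W ψ} (ssc-closedApprox sφ nφ) (ssc-closedApprox sψ nψ)
    ssc-closedApprox (app (fc f) ts _ args) neg =
      closedApprox-fσ f (λ j → W (ts j)) λ j → argC-approx (args j) (neg j)
    ssc-closedApprox (app (gc g) ts () args) neg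
    ssc-closedApprox (app (fsh f i) ts k args) neg =
      closedApprox-≡ (λ _ → sym (⋁⋀-∂ εi≡∂))
        (ResidualF.closedApprox-∂ f i (λ j → W (ts j)) (closedApproxAt-cast εi≡∂ (arg i)) (λ j _ → arg j) εi≡∂)
      where
      εi≡∂ = kindAt-second (λ ()) k
      arg : ∀ j → ClosedApproxAt (εF f j) (W (ts j))
      arg j = closedApproxAt-cast (εres-∂ i (εF f) εi≡∂ j) (argC-approx (args j) (neg j))
    ssc-closedApprox (app (gfl g i) ts k args) neg =
      closedApprox-≡ (λ _ → sym (⋀⋁-one εi≡one))
        (ResidualG.closedApprox-one g i (λ j → W (ts j))
          (closedApproxAt-cast (εres-at i (εG g) εi≡one) (arg i))
          (λ j j≢i → closedApproxAt-flip (εG g j) (closedApproxAt-cast (εres-other i (εG g) εi≡one j≢i) (arg j)))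
          εi≡one)
      where
      εi≡one = kindAt-first isF≢isG k
      arg : ∀ j → ClosedApproxAt (εres i (εG g) j) (W (ts j))
      arg j = argC-approx (args j) (neg j)

    sso-openApprox (var q) _ = openApprox-var q (q ℕ.≟ p)
      where
      openApprox-var : ∀ q → Dec (q ≡ p) → OpenApprox (W (var q))
      openApprox-var q (yes refl) = openApprox-≡ (λ x → sym (override-at ρ q x)) (openApprox-id O-open)
      openApprox-var q (no q≢p)   =
        openApprox-≡ (λ x → sym (override-other ρ p x q≢p)) (openApprox-const (open-e _))
    sso-openApprox (conom m) _ = openApprox-const (meetIrr⇒open (valM-irr v m))
    sso-openApprox ⊤t        _ = openApprox-const open-⊤
    sso-openApprox ⊥t        _ = openApprox-const open-⊥
    sso-openApprox (_∨t_ {φ} {ψ} sφ sψ) (pφ , pψ) =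
      openApprox-∨ {W φ} {W ψ} (sso-openApprox sφ pφ) (sso-openApprox sψ pψ)
    sso-openApprox (_∧t_ {φ} {ψ} sφ sψ) (pφ , pψ) =
      openApprox-∧ {W φ} {W ψ} (sso-openApprox sφ pφ) (sso-openApprox sψ pψ)
    sso-openApprox (app (gc g) ts _ args) pos =
      openApprox-gπ g (λ j → W (ts j)) λ j → argO-approx (args j) (pos j)
    sso-openApprox (app (fc f) ts () args) pos
    sso-openApprox (app (fsh f i) ts k args) pos =
      openApprox-≡ (λ _ → sym (⋁⋀-one εi≡one))
        (ResidualF.openApprox-one f i (λ j → W (ts j))
          (openApproxAt-cast (εres-at i (εF f) εi≡one) (arg i))
          (λ j j≢i → openApproxAt-flip (εF f j) (openApproxAt-cast (εres-other i (εF f) εi≡one j≢i) (arg j)))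
          εi≡one)
      where
      εi≡one = kindAt-first (λ ()) k
      arg : ∀ j → OpenApproxAt (εres i (εF f) j) (W (ts j))
      arg j = argO-approx (args j) (pos j)
    sso-openApprox (app (gfl g i) ts k args) pos =
      openApprox-≡ (λ _ → sym (⋀⋁-∂ εi≡∂))
        (ResidualG.openApprox-∂ g i (λ j → W (ts j)) (openApproxAt-cast εi≡∂ (arg i)) (λ j _ → arg j) εi≡∂)
      where
      εi≡∂ = kindAt-second isF≢isG k
      arg : ∀ j → OpenApproxAt (εG g j) (W (ts j))
      arg j = openApproxAt-cast (εres-∂ i (εG g) εi≡∂ j) (argO-approx (args j) (pos j))

module Ackermann {Sig : Signature} {A : BL} (X : CanExt A) (𝔸 : Slanted Sig A X)
                 (v : Sem.Assignment X 𝔸) (p : ℕ) (α : Syntax.Term Sig)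
                 (α-sso : Syntax.SSO Sig α) (α-noOcc : Syntax.NoOcc Sig p α) where
  open Evaluation X 𝔸
  open PartialOrderReasoning poset

  ρ : ℕ → Carrier
  ρ q = e (valP v q)

  O : Carrier
  O = eval ρ (valN v) (valM v) α

  -- α does not depend on p, so the induction run at any open point, here ⊤, shows O open.
  O-open : Open O
  O-open = open-resp-≈ (proj₁ (sso-openApprox α-sso (noOcc⇒posIn p α α-noOcc)))
                       (eval-noOcc (λ _ → Eq.refl) (λ _ → Eq.refl) p
                                   (λ q q≢p → ≡⇒≈ (override-other ρ p ⊤c q≢p)) α α-noOcc)
    where open Approximation X 𝔸 ⊤c using (module TermApproximation)
          open TermApproximation v p open-⊤ using (sso-openApprox)

  open Approximation X 𝔸 O using (module TermApproximation)
  open TermApproximation v p O-open using (W; ssc-closedApprox; sso-openApprox)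

  ⟦α⟧-invariant : ∀ v' → DiffAtMost p v v' → ⟦ α ⟧ v' ≈ O
  ⟦α⟧-invariant v' (P≡ , N≡ , M≡) = Eq.trans (⟦⟧≈eval α v')
    (eval-noOcc (λ j → ≡⇒≈ (N≡ j)) (λ m → ≡⇒≈ (M≡ m)) p
                (λ q q≢p → ≡⇒≈ (cong e (P≡ q q≢p))) α α-noOcc)

  ⟦subst⟧≈W : ∀ t → ⟦ t [ α / p ] ⟧ v ≈ W t O
  ⟦subst⟧≈W t = Eq.trans (⟦⟧≈eval (t [ α / p ]) v) (eval-subst p ρ (valN v) (valM v) t α)

  ⟦⟧≈W : ∀ v' → DiffAtMost p v v' → ∀ t → ⟦ t ⟧ v' ≈ W t (e (valP v' p))
  ⟦⟧≈W v' (P≡ , N≡ , M≡) t = Eq.trans (⟦⟧≈eval t v')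
    (eval-cong (λ j → ≡⇒≈ (N≡ j)) (λ m → ≡⇒≈ (M≡ m))
               (λ q → ≡⇒≈ (trans (cong e (override-agree p P≡ q)) (override-∘ e (valP v) p _ q))) t)

  inequality-at-O⇒eventually : ∀ {β γ} → SSC β × NegIn p β → SSO γ × PosIn p γ → W β O ≤ W γ O →
                               Eventually O (λ d → W β (e d) ≤ W γ (e d))
  inequality-at-O⇒eventually (β-ssc , β-neg) (γ-sso , γ-pos) β≤γ =
    let (β-closed , β-approx) = ssc-closedApprox β-ssc β-neg
        (γ-open , γ-approx)   = sso-openApprox γ-sso γ-pos
        (c , β≤c , c≤γ)       = interpolate β-closed γ-open β≤γ
    in eventually-map (λ _ (β≤c , c≤γ) → ≤-trans β≤c c≤γ)
                      (eventually-× (β-approx c β≤c) (γ-approx c c≤γ))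

  assignP : A.Carrier → Assignment
  assignP d = record v { valP = override (valP v) p d }

  assignP-diff : ∀ d → DiffAtMost p v (assignP d)
  assignP-diff d = (λ q q≢p → override-other (valP v) p d q≢p) , (λ _ → refl) , (λ _ → refl)

  ⟦⟧-assignP : ∀ d t → ⟦ t ⟧ (assignP d) ≈ W t (e d)
  ⟦⟧-assignP d t = Eq.trans (⟦⟧≈eval t (assignP d))
    (eval-cong (λ _ → Eq.refl) (λ _ → Eq.refl) (λ q → ≡⇒≈ (override-∘ e (valP v) p d q)) t)

  module _ {n} (β γ : Fin n → Term)
           (β-ssc : ∀ i → SSC (β i) × NegIn p (β i)) (γ-sso : ∀ i → SSO (γ i) × PosIn p (γ i)) where

    substituted⇒eventually : (∀ i → v ⊨ (β i [ α / p ]) ≤t (γ i [ α / p ])) →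
                             Eventually O (λ d → ∀ i → W (β i) (e d) ≤ W (γ i) (e d))
    substituted⇒eventually substituted = eventually-∀Fin n λ i →
      inequality-at-O⇒eventually (β-ssc i) (γ-sso i) (begin
        W (β i) O            ≈⟨ Eq.sym (⟦subst⟧≈W (β i)) ⟩
        ⟦ β i [ α / p ] ⟧ v  ≤⟨ substituted i ⟩
        ⟦ γ i [ α / p ] ⟧ v  ≈⟨ ⟦subst⟧≈W (γ i) ⟩
        W (γ i) O            ∎)

    assignP-models : ∀ d → e d ≤ O → (∀ i → W (β i) (e d) ≤ W (γ i) (e d)) →
                     assignP d ⊨ var p ≤t α × (∀ i → assignP d ⊨ β i ≤t γ i)
    assignP-models d d≤O β≤γ = p≤α , λ i → begin
        ⟦ β i ⟧ (assignP d)  ≈⟨ ⟦⟧-assignP d (β i) ⟩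
        W (β i) (e d)        ≤⟨ β≤γ i ⟩
        W (γ i) (e d)        ≈⟨ Eq.sym (⟦⟧-assignP d (γ i)) ⟩
        ⟦ γ i ⟧ (assignP d)  ∎
      where
      p≤α : assignP d ⊨ var p ≤t α
      p≤α = begin
        e (override (valP v) p d p)  ≡⟨ cong e (override-at (valP v) p d) ⟩
        e d                          ≤⟨ d≤O ⟩
        O                            ≈⟨ Eq.sym (⟦α⟧-invariant (assignP d) (assignP-diff d)) ⟩
        ⟦ α ⟧ (assignP d)            ∎

    ackermann-⇒ : (∀ i → v ⊨ (β i [ α / p ]) ≤t (γ i [ α / p ])) →
                  Σ Assignment λ v' → DiffAtMost p v v' × v' ⊨ var p ≤t α × (∀ i → v' ⊨ β i ≤t γ i)
    ackermann-⇒ substituted =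
      let (d , d≤O , β≤γ) = substituted⇒eventually substituted
      in assignP d , assignP-diff d , assignP-models d d≤O (β≤γ d A.refl d≤O)

    ackermann-⇐ : Σ Assignment (λ v' → DiffAtMost p v v' × v' ⊨ var p ≤t α × (∀ i → v' ⊨ β i ≤t γ i)) →
                  ∀ i → v ⊨ (β i [ α / p ]) ≤t (γ i [ α / p ])
    ackermann-⇐ (v' , diff , p≤α , β≤γ) i = begin
      ⟦ β i [ α / p ] ⟧ v  ≈⟨ ⟦subst⟧≈W (β i) ⟩
      W (β i) O            ≤⟨ eval-negIn-anti p off-p at-p (β i) (proj₂ (β-ssc i)) ⟩
      W (β i) x'           ≈⟨ Eq.sym (⟦⟧≈W v' diff (β i)) ⟩
      ⟦ β i ⟧ v'           ≤⟨ β≤γ i ⟩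
      ⟦ γ i ⟧ v'           ≈⟨ ⟦⟧≈W v' diff (γ i) ⟩
      W (γ i) x'           ≤⟨ eval-posIn-mono p off-p at-p (γ i) (proj₂ (γ-sso i)) ⟩
      W (γ i) O            ≈⟨ Eq.sym (⟦subst⟧≈W (γ i)) ⟩
      ⟦ γ i [ α / p ] ⟧ v  ∎
      where
      x' = e (valP v' p)
      off-p : ∀ q → q ≢ p → override ρ p x' q ≈ override ρ p O q
      off-p q q≢p = ≡⇒≈ (trans (override-other ρ p x' q≢p) (sym (override-other ρ p O q≢p)))
      at-p : override ρ p x' p ≤ override ρ p O p
      at-p rewrite override-at ρ p x' | override-at ρ p O = ≤-trans p≤α (≈⇒≤ (⟦α⟧-invariant v' diff))

lemma4p7 : (Sig : Signature) (A : BL) (X : CanExt A) (𝔸 : Slanted Sig A X)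
    (v : Sem.Assignment X 𝔸) (p : ℕ) (α : Syntax.Term Sig) →
    Syntax.SSO Sig α → Syntax.NoOcc Sig p α →
    (n : ℕ) (β γ : Fin n → Syntax.Term Sig) →
    (∀ i → Syntax.SSC Sig (β i) × Syntax.NegIn Sig p (β i)) →
    (∀ i → Syntax.SSO Sig (γ i) × Syntax.PosIn Sig p (γ i)) →
    ((∀ i → Sem._⊨_≤t_ X 𝔸 v (Syntax._[_/_] Sig (β i) α p) (Syntax._[_/_] Sig (γ i) α p))
     ⇔ Σ (Sem.Assignment X 𝔸) (λ v' → Sem.DiffAtMost X 𝔸 p v v'
          × Sem._⊨_≤t_ X 𝔸 v' (Syntax.Term.var p) α
          × (∀ i → Sem._⊨_≤t_ X 𝔸 v' (β i) (γ i))))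
lemma4p7 Sig A X 𝔸 v p α α-sso α-noOcc n β γ β-ssc γ-sso =
  mk⇔ (ackermann-⇒ β γ β-ssc γ-sso) (ackermann-⇐ β γ β-ssc γ-sso)
  where open Ackermann X 𝔸 v p α α-sso α-noOcc
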